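{- Let $F:\mathbb{F}_{2^m}\to\mathbb{F}_{2^m}$. If there exists $c\in\mathbb{F}_{2^m}^*$ such that $d^{\circ}(tr(cF))\notin\{0,1,d^{\circ}(F)\}$, then $F$ is EA-inequivalent to every power function.
   Context: $tr(x)=x+x^2+\dots+x^{2^{m-1}}$ is the absolute trace. The algebraic degree $d^{\circ}(F)$ of $F(x)=\sum_{j=0}^{2^m-1}c_jx^j$ (unique univariate representation, $c_j\in\mathbb{F}_{2^m}$) is the maximum binary weight $w_2(j)$ over $j$ with $c_j\neq0$ (equivalently the degree of its algebraic normal form); this applies also to Boolean functions $\mathbb{F}_{2^m}\to\mathbb{F}_2$. A function is affine if it is a linearized polynomial $\sum_j c_jx^{2^j}$ plus a constant. $F,F'$ are EA-equivalent if $F'=A_1\circ F\circ A_2+A$ with $A_1,A_2$ affine permutations and $A$ affine. A power function is $x\mapsto x^d$. -}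

module Defs where

open import Level using (Level; suc; _⊔_)
open import Data.Nat as ℕ using (ℕ; zero; _≤_)
open import Data.Nat.DivMod using (_/_; _%_)
open import Data.Fin using (Fin; toℕ)
open import Data.Product using (Σ; ∃; ∃-syntax; _×_; _,_)
open import Data.Sum using (_⊎_)
open import Function using (Bijective)
open import Function.Bundles using (_↔_)
open import Relation.Binary.PropositionalEquality using (_≡_; _≢_)
open import Relation.Nullary using (¬_)
open import Algebra.Structures using (IsCommutativeRing)

-- Binary weight w₂(n): number of ones in the binary expansion of n.
-- (Uses fuel = n, which is always enough.)
w₂-fuel : ℕ → ℕ → ℕ
w₂-fuel zero      n = 0
w₂-fuel (ℕ.suc f) n = n % 2 ℕ.+ w₂-fuel f (n / 2)

w₂ : ℕ → ℕ
w₂ n = w₂-fuel n n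

-- A finite field with 2^m elements (the field F_{2^m}; it is unique up to
-- isomorphism, so we quantify over all such fields).
record GF2^ (m : ℕ) (a : Level) : Set (suc a) where
  infixl 6 _+_
  infixl 7 _*_
  field
    K          : Set a
    _+_ _*_    : K → K → K
    -_         : K → K
    0# 1#      : K
    isCommRing : IsCommutativeRing _≡_ _+_ _*_ -_ 0# 1#
    0≢1        : 0# ≢ 1#
    inverse    : ∀ x → x ≢ 0# → ∃[ y ] (x * y ≡ 1#)
    card       : Fin (2 ℕ.^ m) ↔ K

  -- natural-number powers, with x ^ 0 = 1 (also for x = 0)
  infixr 8 _^_
  _^_ : K → ℕ → K
  x ^ zero      = 1#
  x ^ ℕ.suc n = x * (x ^ n)

  Σ< : (n : ℕ) → (Fin n → K) → K
  Σ< zero    f = 0#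
  Σ< (ℕ.suc n) f = f Fin.zero + Σ< n (λ j → f (Fin.suc j))
    where import Data.Fin as Fin

  q : ℕ
  q = 2 ℕ.^ m

  tr : K → K
  tr x = Σ< m (λ i → x ^ (2 ℕ.^ toℕ i))

  Represents : (Fin q → K) → (K → K) → Set a
  Represents c F = ∀ x → F x ≡ Σ< q (λ j → c j * x ^ toℕ j)

  MaxWeight : (Fin q → K) → ℕ → Set a
  MaxWeight c d =
    (∀ j → c j ≢ 0# → w₂ (toℕ j) ≤ d) ×
    (d ≡ 0 ⊎ ∃[ j ] (c j ≢ 0# × w₂ (toℕ j) ≡ d))

  -- d°(F) = d : the algebraic degree of F (via its univariate representation,
  -- which exists and is unique)
  AlgDeg : (K → K) → ℕ → Set a
  AlgDeg F d = Σ (Fin q → K) λ c → (Represents c F × MaxWeight c d)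

  Affine : (K → K) → Set a
  Affine A = Σ (Fin m → K) λ c → Σ K λ b → (∀ x → A x ≡ Σ< m (λ j → c j * x ^ (2 ℕ.^ toℕ j)) + b)

  AffinePerm : (K → K) → Set a
  AffinePerm A = Affine A × Bijective _≡_ _≡_ A

  EAEquivalent : (K → K) → (K → K) → Set a
  EAEquivalent F F' =
    Σ (K → K) λ A₁ → Σ (K → K) λ A₂ → Σ (K → K) λ A → (
          AffinePerm A₁ × AffinePerm A₂ × Affine A ×
      (∀ x → F' x ≡ A₁ (F (A₂ x)) + A x))

  power : ℕ → K → K
  power d x = x ^ d

module Submission where

-- d°(G) ≤ k exactly when every k-fold derivative of G, with Δ b G x = G (x + b) + G x,
-- is constant. In this form degree bounds k ≥ 1 are visibly preserved by
-- F ↦ A₁ ∘ F ∘ A₂ + A, and d°(tr(cF)) ≤ d°(F) because x ↦ tr(cx) is additive.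
-- If F is EA-equivalent to x^d, then tr(cF) is, up to composition with A₂ and an
-- affine summand, β(x^d) for an additive β, i.e. a linearised polynomial
-- Σ bᵢ x^(2^i). If tr(cF) is not affine, some monomial x^(d 2^i) of β(x^d)
-- survives in its reduced form, and x^d is a Frobenius power of it, so
-- d°(F) = d°(x^d) ≤ d°(tr(cF)). Hence d°(tr(cF)) = d°(F).
-- Matching derivatives with the binary-weight definition of d° rests on
-- recovering the x^j-term of G as Σ_t t^(q-1-j) G(tx), by the vanishing of the
-- power sums Σ_t t^l for 0 < l < 2(q-1), l ≠ q-1.

open import Defs
open import Level using (Level)
open import Data.Nat as ℕ using (ℕ; zero; suc; z≤n; s≤s; _/_; _%_)
import Data.Nat.Properties as ℕP
import Algebra.Properties.CommutativeSemigroup ℕP.+-commutativeSemigroup as ℕ+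
import Data.Nat.DivMod as ℕDM
import Data.Nat.Divisibility as ℕDivisibility
open import Data.Nat.Induction using (<-rec)
open import Data.Maybe using (nothing)
open import Data.Product using (Σ; ∃-syntax; _×_; _,_; proj₁; proj₂)
open import Data.Sum using (_⊎_; inj₁; inj₂)
open import Relation.Nullary.Decidable using (_⊎-dec_)
open import Relation.Binary.Definitions using (tri<; tri≈; tri>)
open import Data.Empty using (⊥-elim)
open import Relation.Binary.PropositionalEquality
open import Relation.Nullary using (¬_; Dec; yes; no)
open import Data.Fin as Fin using (Fin; toℕ)
import Data.Fin.Properties as FinP
import Data.Fin.Permutation as Perm
open import Function using (_∘_; flip; Bijective)
open import Function.Bundles using (Inverse)
open import Algebra.Bundles using (CommutativeRing)
open import Algebra.Structures using (IsCommutativeRing)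
import Tactic.RingSolver.Core.AlmostCommutativeRing as ACR
open import Data.Nat.Combinatorics using (_C_; nCk≡nC[n∸k]; nC1≡n)
import Algebra.Properties.CommutativeSemiring.Binomial as Binomial

data Halving : ℕ → Set where
  zero : Halving 0
  even : ∀ h → Halving (suc h ℕ.* 2)
  odd  : ∀ h → Halving (suc (h ℕ.* 2))

halving : ∀ n → Halving n
halving zero = zero
halving (suc zero) = odd 0
halving (suc (suc n)) with halving n
... | zero   = even 0
... | even h = even (suc h)
... | odd h  = odd (suc h)

halving-ind : ∀ {ℓ} (P : ℕ → Set ℓ) → P 0 →
  (∀ h → (∀ {i} → i ℕ.< suc h ℕ.* 2 → P i) → P (suc h ℕ.* 2)) →
  (∀ h → (∀ {i} → i ℕ.< suc (h ℕ.* 2) → P i) → P (suc (h ℕ.* 2))) →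
  ∀ n → P n
halving-ind P p0 pe po = <-rec P step
  where
  step : ∀ n → (∀ {i} → i ℕ.< n → P i) → P n
  step n rec with halving n
  ... | zero   = p0
  ... | even h = pe h rec
  ... | odd h  = po h rec

half<double : ∀ h → suc h ℕ.< suc h ℕ.* 2
half<double h = ℕP.m<m*n (suc h) 2 ℕP.≤-refl

half≤ : ∀ n k → n ℕ.≤ suc k → n / 2 ℕ.≤ k
half≤ zero    k _   = z≤n
half≤ (suc n) k n≤k = ℕP.≤-pred (ℕP.<-≤-trans (ℕDM.m/n<m (suc n) 2 ℕP.≤-refl) n≤k)

w₂-fuel-irrelevant : ∀ f g n → n ℕ.≤ f → n ℕ.≤ g → w₂-fuel f n ≡ w₂-fuel g n
w₂-fuel-irrelevant zero    zero    _    _   _   = refl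
w₂-fuel-irrelevant zero    (suc g) zero _   _   = w₂-fuel-irrelevant zero g 0 z≤n z≤n
w₂-fuel-irrelevant (suc f) zero    zero _   _   = w₂-fuel-irrelevant f zero 0 z≤n z≤n
w₂-fuel-irrelevant (suc f) (suc g) n    n≤f n≤g =
  cong (n % 2 ℕ.+_) (w₂-fuel-irrelevant f g (n / 2) (half≤ n f n≤f) (half≤ n g n≤g))

w₂-step : ∀ n → w₂ n ≡ n % 2 ℕ.+ w₂ (n / 2)
w₂-step zero    = refl
w₂-step (suc n) =
  cong (suc n % 2 ℕ.+_) (w₂-fuel-irrelevant n (suc n / 2) (suc n / 2) (half≤ (suc n) n ℕP.≤-refl) ℕP.≤-refl)

w₂-even : ∀ h → w₂ (h ℕ.* 2) ≡ w₂ h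
w₂-even h = trans (w₂-step (h ℕ.* 2)) (cong₂ ℕ._+_ (ℕDM.m*n%n≡0 h 2) (cong w₂ (ℕDM.m*n/n≡m h 2)))

w₂-odd : ∀ h → w₂ (suc (h ℕ.* 2)) ≡ suc (w₂ h)
w₂-odd h = trans (w₂-step (suc (h ℕ.* 2)))
  (cong₂ ℕ._+_ (ℕDM.[m+kn]%n≡m%n 1 h 2) (cong w₂ [1+2h]/2≡h))
  where
  [1+2h]/2≡h : suc (h ℕ.* 2) / 2 ≡ h
  [1+2h]/2≡h = trans (ℕDM.+-distrib-/-∣ʳ 1 {d = 2} (ℕDivisibility.divides-refl h)) (ℕDM.m*n/n≡m h 2)

w₂≡0⇒≡0 : ∀ n → w₂ n ≡ 0 → n ≡ 0
w₂≡0⇒≡0 = halving-ind _ (λ _ → refl) even-case odd-case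
  where
  even-case : ∀ h → (∀ {i} → i ℕ.< suc h ℕ.* 2 → w₂ i ≡ 0 → i ≡ 0) →
              w₂ (suc h ℕ.* 2) ≡ 0 → suc h ℕ.* 2 ≡ 0
  even-case h rec w≡0 with rec (half<double h) (trans (sym (w₂-even (suc h))) w≡0)
  ... | ()
  odd-case : ∀ h → (∀ {i} → i ℕ.< suc (h ℕ.* 2) → w₂ i ≡ 0 → i ≡ 0) →
             w₂ (suc (h ℕ.* 2)) ≡ 0 → suc (h ℕ.* 2) ≡ 0
  odd-case h _ w≡0 with trans (sym (w₂-odd h)) w≡0
  ... | ()

w₂≡1⇒≡2^ : ∀ n → w₂ n ≡ 1 → ∃[ i ] n ≡ 2 ℕ.^ i
w₂≡1⇒≡2^ = halving-ind _ (λ ()) even-case odd-case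
  where
  even-case : ∀ h → (∀ {i} → i ℕ.< suc h ℕ.* 2 → w₂ i ≡ 1 → ∃[ j ] i ≡ 2 ℕ.^ j) →
              w₂ (suc h ℕ.* 2) ≡ 1 → ∃[ j ] suc h ℕ.* 2 ≡ 2 ℕ.^ j
  even-case h rec w≡1 with rec (half<double h) (trans (sym (w₂-even (suc h))) w≡1)
  ... | i , h+1≡2^i = suc i , trans (cong (ℕ._* 2) h+1≡2^i) (ℕP.*-comm (2 ℕ.^ i) 2)
  odd-case : ∀ h → (∀ {i} → i ℕ.< suc (h ℕ.* 2) → w₂ i ≡ 1 → ∃[ j ] i ≡ 2 ℕ.^ j) →
             w₂ (suc (h ℕ.* 2)) ≡ 1 → ∃[ j ] suc (h ℕ.* 2) ≡ 2 ℕ.^ j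
  odd-case h _ w≡1 = 0 , cong (λ k → suc (k ℕ.* 2)) (w₂≡0⇒≡0 h (ℕP.suc-injective (trans (sym (w₂-odd h)) w≡1)))

module Field {a : Level} {m : ℕ} (𝔽 : GF2^ (suc m) a) where

  open GF2^ 𝔽
  open IsCommutativeRing isCommRing using
    ( +-assoc; +-comm; +-identityˡ; +-identityʳ; *-assoc; *-comm; *-identityˡ; *-identityʳ
    ; distribˡ; distribʳ; zeroˡ; zeroʳ; -‿inverseˡ; -‿inverseʳ )
  open ≡-Reasoning

  ring : CommutativeRing a a
  ring = record { isCommutativeRing = isCommRing }

  open import Tactic.RingSolver.NonReflective (ACR.fromCommutativeRing ring (λ _ → nothing)) using (solve; _⊜_; _⊕_; _⊗_)

  open CommutativeRing ring using
    (+-abelianGroup; +-commutativeSemigroup; *-commutativeSemigroup; *-commutativeMonoid; semiring; commutativeSemiring)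
  open import Algebra.Properties.CommutativeSemigroup +-commutativeSemigroup using ()
    renaming (interchange to +-interchange; xy∙z≈xz∙y to +-xy+z≡xz+y)
  open import Algebra.Properties.CommutativeSemigroup *-commutativeSemigroup using ()
    renaming (x∙yz≈y∙xz to x*[y*z]≡y*[x*z])
  open import Algebra.Properties.AbelianGroup +-abelianGroup using (identityʳ-unique)
    renaming (∙-cancelʳ to +-cancelʳ)
  open import Algebra.Properties.Semiring.Sum semiring using
    (sum; sum-cong-≗; sum-replicate; sum-permute; ∑-distrib-+; ∑-comm; *-distribˡ-sum)
  open import Algebra.Properties.Semiring.Mult semiring using (×1-homo-*; ×-assoc-*)
    renaming (_×_ to _·_)
  open import Algebra.Properties.Semiring.Exp semiring using () renaming (_^_ to _^ᴿ_)
  module BinomialTheorem = Binomial commutativeSemiring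
  open import Algebra.Properties.CommutativeMonoid.Sum *-commutativeMonoid using ()
    renaming (sum to prod; sum-cong-≗ to prod-cong-≗; sum-permute to prod-permute; ∑-distrib-+ to prod-distrib-*)

  enum : Fin q → K
  enum = Inverse.to card

  index : K → Fin q
  index = Inverse.from card

  enum-index : ∀ x → enum (index x) ≡ x
  enum-index = Inverse.strictlyInverseˡ card

  index-enum : ∀ i → index (enum i) ≡ i
  index-enum = Inverse.strictlyInverseʳ card

  enum-injective : ∀ {i j} → enum i ≡ enum j → i ≡ j
  enum-injective {i} {j} eq = trans (sym (index-enum i)) (trans (cong index eq) (index-enum j))

  infix 4 _≟_
  _≟_ : (x y : K) → Dec (x ≡ y)
  x ≟ y with index x Fin.≟ index y
  ... | yes eq = yes (trans (sym (enum-index x)) (trans (cong enum eq) (enum-index y)))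
  ... | no neq = no (neq ∘ cong index)

  p : ℕ
  p = ℕ.pred q

  q≡1+p : q ≡ suc p
  q≡1+p = sym (ℕP.suc-pred q {{ℕP.m^n≢0 2 (suc m)}})

  1≤p : 1 ℕ.≤ p
  1≤p = ℕP.≤-pred (subst (2 ℕ.≤_) q≡1+p (ℕP.*-monoʳ-≤ 2 (ℕP.m^n>0 2 m)))

  Σ<≡sum : ∀ n (f : Fin n → K) → Σ< n f ≡ sum f
  Σ<≡sum zero    f = refl
  Σ<≡sum (suc n) f = cong (f Fin.zero +_) (Σ<≡sum n (f ∘ Fin.suc))

  Σ-cong : ∀ n {f g : Fin n → K} → (∀ i → f i ≡ g i) → Σ< n f ≡ Σ< n g
  Σ-cong zero    f≗g = refl
  Σ-cong (suc n) f≗g = cong₂ _+_ (f≗g Fin.zero) (Σ-cong n (f≗g ∘ Fin.suc))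

  Σ-zero : ∀ n {f : Fin n → K} → (∀ i → f i ≡ 0#) → Σ< n f ≡ 0#
  Σ-zero zero    f≗0 = refl
  Σ-zero (suc n) f≗0 = trans (cong₂ _+_ (f≗0 Fin.zero) (Σ-zero n (f≗0 ∘ Fin.suc))) (+-identityˡ 0#)

  Σ-+ : ∀ n (f g : Fin n → K) → Σ< n (λ i → f i + g i) ≡ Σ< n f + Σ< n g
  Σ-+ n f g = begin
    Σ< n (λ i → f i + g i) ≡⟨ Σ<≡sum n _ ⟩
    sum (λ i → f i + g i)  ≡⟨ ∑-distrib-+ f g ⟩
    sum f + sum g          ≡⟨ sym (cong₂ _+_ (Σ<≡sum n f) (Σ<≡sum n g)) ⟩
    Σ< n f + Σ< n g        ∎

  Σ-*ˡ : ∀ n c (f : Fin n → K) → c * Σ< n f ≡ Σ< n (λ i → c * f i)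
  Σ-*ˡ n c f = begin
    c * Σ< n f            ≡⟨ cong (c *_) (Σ<≡sum n f) ⟩
    c * sum f             ≡⟨ *-distribˡ-sum c f ⟩
    sum (λ i → c * f i)   ≡⟨ sym (Σ<≡sum n _) ⟩
    Σ< n (λ i → c * f i)  ∎

  Σ-*ʳ : ∀ n c (f : Fin n → K) → Σ< n f * c ≡ Σ< n (λ i → f i * c)
  Σ-*ʳ n c f = trans (*-comm _ c) (trans (Σ-*ˡ n c f) (Σ-cong n (λ i → *-comm c (f i))))

  Σ-comm : ∀ n k (f : Fin n → Fin k → K) → Σ< n (λ i → Σ< k (f i)) ≡ Σ< k (λ j → Σ< n (λ i → f i j))
  Σ-comm n k f = begin
    Σ< n (λ i → Σ< k (f i))         ≡⟨ trans (Σ-cong n (λ i → Σ<≡sum k (f i))) (Σ<≡sum n _) ⟩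
    sum (λ i → sum (f i))           ≡⟨ ∑-comm f ⟩
    sum (λ j → sum (λ i → f i j))   ≡⟨ sym (trans (Σ-cong k (λ j → Σ<≡sum n _)) (Σ<≡sum k _)) ⟩
    Σ< k (λ j → Σ< n (λ i → f i j)) ∎

  Σ-single : ∀ n (f : Fin n → K) i → (∀ j → j ≢ i → f j ≡ 0#) → Σ< n f ≡ f i
  Σ-single (suc n) f Fin.zero off =
    trans (cong (f Fin.zero +_) (Σ-zero n (λ j → off (Fin.suc j) λ ()))) (+-identityʳ _)
  Σ-single (suc n) f (Fin.suc i) off =
    trans (cong₂ _+_ (off Fin.zero λ ()) (Σ-single n (f ∘ Fin.suc) i (λ j j≢i → off (Fin.suc j) (j≢i ∘ FinP.suc-injective))))
          (+-identityˡ _)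

  ΣK : (K → K) → K
  ΣK f = Σ< q (f ∘ enum)

  ΠK : (K → K) → K
  ΠK f = prod (f ∘ enum)

  module _ {σ σ⁻¹ : K → K} (σ∘σ⁻¹ : ∀ y → σ (σ⁻¹ y) ≡ y) (σ⁻¹∘σ : ∀ y → σ⁻¹ (σ y) ≡ y) where
    private
      π : Perm.Permutation q q
      π = Perm.permutation (index ∘ σ ∘ enum) (index ∘ σ⁻¹ ∘ enum)
        (λ i → trans (cong (index ∘ σ) (enum-index _)) (trans (cong index (σ∘σ⁻¹ _)) (index-enum i)))
        (λ i → trans (cong (index ∘ σ⁻¹) (enum-index _)) (trans (cong index (σ⁻¹∘σ _)) (index-enum i)))

    ΣK-reindex : ∀ f → ΣK f ≡ ΣK (f ∘ σ)
    ΣK-reindex f = begin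
      ΣK f                                      ≡⟨ Σ<≡sum q _ ⟩
      sum (λ i → f (enum i))                    ≡⟨ sum-permute (f ∘ enum) π ⟩
      sum (λ i → f (enum (index (σ (enum i))))) ≡⟨ sum-cong-≗ (λ i → cong f (enum-index (σ (enum i)))) ⟩
      sum (λ i → f (σ (enum i)))                ≡⟨ sym (Σ<≡sum q _) ⟩
      ΣK (f ∘ σ)                                ∎

    ΠK-reindex : ∀ f → ΠK f ≡ ΠK (f ∘ σ)
    ΠK-reindex f = trans (prod-permute (f ∘ enum) π) (prod-cong-≗ (λ i → cong f (enum-index (σ (enum i)))))

  -- Characteristic 2 and Fermat's little theorem

  *-cancelˡ : ∀ {x y z} → x ≢ 0# → x * y ≡ x * z → y ≡ z
  *-cancelˡ {x} {y} {z} x≢0 xy≡xz with inverse x x≢0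
  ... | x⁻¹ , xx⁻¹≡1 = begin
    y              ≡⟨ sym (*-identityˡ y) ⟩
    1# * y         ≡⟨ cong (_* y) (trans (sym xx⁻¹≡1) (*-comm x x⁻¹)) ⟩
    (x⁻¹ * x) * y  ≡⟨ *-assoc x⁻¹ x y ⟩
    x⁻¹ * (x * y)  ≡⟨ cong (x⁻¹ *_) xy≡xz ⟩
    x⁻¹ * (x * z)  ≡⟨ sym (*-assoc x⁻¹ x z) ⟩
    (x⁻¹ * x) * z  ≡⟨ cong (_* z) (trans (*-comm x⁻¹ x) xx⁻¹≡1) ⟩
    1# * z         ≡⟨ *-identityˡ z ⟩
    z              ∎

  x*y≡0⇒y≡0 : ∀ {x y} → x ≢ 0# → x * y ≡ 0# → y ≡ 0#
  x*y≡0⇒y≡0 {x} x≢0 xy≡0 = *-cancelˡ x≢0 (trans xy≡0 (sym (zeroʳ x)))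

  *-nonzero : ∀ {x y} → x ≢ 0# → y ≢ 0# → x * y ≢ 0#
  *-nonzero x≢0 y≢0 = y≢0 ∘ x*y≡0⇒y≡0 x≢0

  ^-homo-* : ∀ x i j → x ^ (i ℕ.+ j) ≡ x ^ i * x ^ j
  ^-homo-* x zero    j = sym (*-identityˡ _)
  ^-homo-* x (suc i) j = trans (cong (x *_) (^-homo-* x i j)) (sym (*-assoc x _ _))

  ^-distrib-* : ∀ x y n → (x * y) ^ n ≡ x ^ n * y ^ n
  ^-distrib-* x y zero    = sym (*-identityˡ 1#)
  ^-distrib-* x y (suc n) = begin
    (x * y) * (x * y) ^ n        ≡⟨ cong ((x * y) *_) (^-distrib-* x y n) ⟩
    (x * y) * (x ^ n * y ^ n)    ≡⟨ *-assoc x y _ ⟩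
    x * (y * (x ^ n * y ^ n))    ≡⟨ cong (x *_) (trans (sym (*-assoc y _ _)) (cong (_* y ^ n) (*-comm y _))) ⟩
    x * ((x ^ n * y) * y ^ n)    ≡⟨ cong (x *_) (*-assoc _ y _) ⟩
    x * (x ^ n * (y * y ^ n))    ≡⟨ sym (*-assoc x _ _) ⟩
    (x * x ^ n) * (y * y ^ n)    ∎

  1^n≡1 : ∀ n → 1# ^ n ≡ 1#
  1^n≡1 zero    = refl
  1^n≡1 (suc n) = trans (*-identityˡ _) (1^n≡1 n)

  ^-assocʳ : ∀ x i j → (x ^ i) ^ j ≡ x ^ (i ℕ.* j)
  ^-assocʳ x zero    j = 1^n≡1 j
  ^-assocʳ x (suc i) j = begin
    (x * x ^ i) ^ j        ≡⟨ ^-distrib-* x (x ^ i) j ⟩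
    x ^ j * (x ^ i) ^ j    ≡⟨ cong (x ^ j *_) (^-assocʳ x i j) ⟩
    x ^ j * x ^ (i ℕ.* j)  ≡⟨ sym (^-homo-* x j (i ℕ.* j)) ⟩
    x ^ (j ℕ.+ i ℕ.* j)    ∎

  0^n≡0 : ∀ {n} → 1 ℕ.≤ n → 0# ^ n ≡ 0#
  0^n≡0 {suc n} _ = zeroˡ _

  ^-nonzero : ∀ {x} n → x ≢ 0# → x ^ n ≢ 0#
  ^-nonzero zero    x≢0 1≡0 = 0≢1 (sym 1≡0)
  ^-nonzero (suc n) x≢0     = *-nonzero x≢0 (^-nonzero n x≢0)

  +-shift : ∀ b c → b + c ≡ 0# → ∀ y → (y + b) + c ≡ y
  +-shift b c b+c≡0 y = trans (+-assoc y b c) (trans (cong (y +_) b+c≡0) (+-identityʳ y))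

  q·1≡0 : q · 1# ≡ 0#
  q·1≡0 = identityʳ-unique (ΣK (λ x → x)) (q · 1#) (sym (begin
    ΣK (λ x → x)
      ≡⟨ ΣK-reindex {σ = _+ 1#} (+-shift (- 1#) 1# (-‿inverseˡ 1#)) (+-shift 1# (- 1#) (-‿inverseʳ 1#)) (λ x → x) ⟩
    ΣK (λ x → x + 1#)              ≡⟨ Σ-+ q enum (λ _ → 1#) ⟩
    ΣK (λ x → x) + Σ< q (λ _ → 1#) ≡⟨ cong (ΣK (λ x → x) +_) (trans (Σ<≡sum q _) (sum-replicate q)) ⟩
    ΣK (λ x → x) + q · 1#          ∎))

  2^k·1≡[1+1]^k : ∀ k → (2 ℕ.^ k) · 1# ≡ (1# + 1#) ^ k
  2^k·1≡[1+1]^k zero    = +-identityʳ 1#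
  2^k·1≡[1+1]^k (suc k) = begin
    (2 ℕ.* 2 ℕ.^ k) · 1#            ≡⟨ ×1-homo-* 2 (2 ℕ.^ k) ⟩
    (1# + (1# + 0#)) * (2 ℕ.^ k) · 1# ≡⟨ cong₂ _*_ (cong (1# +_) (+-identityʳ 1#)) (2^k·1≡[1+1]^k k) ⟩
    (1# + 1#) * (1# + 1#) ^ k        ∎

  1+1≡0 : 1# + 1# ≡ 0#
  1+1≡0 with 1# + 1# ≟ 0#
  ... | yes 2≡0 = 2≡0
  ... | no  2≢0 = ⊥-elim (^-nonzero (suc m) 2≢0 (trans (sym (2^k·1≡[1+1]^k (suc m))) q·1≡0))

  x+x≡0 : ∀ x → x + x ≡ 0#
  x+x≡0 x = begin
    x + x              ≡⟨ sym (cong₂ _+_ (*-identityˡ x) (*-identityˡ x)) ⟩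
    1# * x + 1# * x    ≡⟨ sym (distribʳ x 1# 1#) ⟩
    (1# + 1#) * x      ≡⟨ cong (_* x) 1+1≡0 ⟩
    0# * x             ≡⟨ zeroˡ x ⟩
    0#                 ∎

  x+y≡0⇒x≡y : ∀ {x y} → x + y ≡ 0# → x ≡ y
  x+y≡0⇒x≡y {x} {y} x+y≡0 = +-cancelʳ y x y (trans x+y≡0 (sym (x+x≡0 y)))


  x+y+[z+z]≡x+y : ∀ x y z → (x + y) + (z + z) ≡ x + y
  x+y+[z+z]≡x+y x y z = trans (cong (x + y +_) (x+x≡0 z)) (+-identityʳ _)

  x+[x+y]≡y : ∀ x y → x + (x + y) ≡ y
  x+[x+y]≡y x y = trans (sym (+-assoc x x y)) (trans (cong (_+ y) (x+x≡0 x)) (+-identityˡ y))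

  x≡y+z⇒y≡x+z : ∀ {x y z} → x ≡ y + z → y ≡ x + z
  x≡y+z⇒y≡x+z {x} {y} {z} x≡y+z = sym (begin
    x + z        ≡⟨ cong (_+ z) x≡y+z ⟩
    (y + z) + z  ≡⟨ +-assoc y z z ⟩
    y + (z + z)  ≡⟨ cong (y +_) (x+x≡0 z) ⟩
    y + 0#       ≡⟨ +-identityʳ y ⟩
    y            ∎)

  prod-nonzero : ∀ n (f : Fin n → K) → (∀ i → f i ≢ 0#) → prod f ≢ 0#
  prod-nonzero zero    f _   1≡0 = 0≢1 (sym 1≡0)
  prod-nonzero (suc n) f f≢0     = *-nonzero (f≢0 Fin.zero) (prod-nonzero n (f ∘ Fin.suc) (f≢0 ∘ Fin.suc))

  prod-const : ∀ n {f : Fin n → K} {c} → (∀ i → f i ≡ c) → prod f ≡ c ^ n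
  prod-const zero    f≗c = refl
  prod-const (suc n) f≗c = cong₂ _*_ (f≗c Fin.zero) (prod-const n (f≗c ∘ Fin.suc))

  prod-constExcept : ∀ n (f : Fin n → K) {c} i → f i ≡ 1# → (∀ j → j ≢ i → f j ≡ c) → prod f * c ≡ c ^ n
  prod-constExcept (suc n) f {c} Fin.zero fi≡1 f≗c = begin
    (f Fin.zero * prod (f ∘ Fin.suc)) * c ≡⟨ cong (λ u → (u * prod (f ∘ Fin.suc)) * c) fi≡1 ⟩
    (1# * prod (f ∘ Fin.suc)) * c         ≡⟨ cong (_* c) (*-identityˡ _) ⟩
    prod (f ∘ Fin.suc) * c                ≡⟨ *-comm _ c ⟩
    c * prod (f ∘ Fin.suc)                ≡⟨ cong (c *_) (prod-const n (λ j → f≗c (Fin.suc j) λ ())) ⟩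
    c * c ^ n                             ∎
  prod-constExcept (suc n) f {c} (Fin.suc i) fi≡1 f≗c = begin
    (f Fin.zero * prod (f ∘ Fin.suc)) * c ≡⟨ *-assoc _ _ c ⟩
    f Fin.zero * (prod (f ∘ Fin.suc) * c)
      ≡⟨ cong₂ _*_ (f≗c Fin.zero λ ())
                   (prod-constExcept n (f ∘ Fin.suc) i fi≡1 (λ j j≢i → f≗c (Fin.suc j) (j≢i ∘ FinP.suc-injective))) ⟩
    c * c ^ n                             ∎

  u*[v*y]≡y : ∀ {u v} → u * v ≡ 1# → ∀ y → u * (v * y) ≡ y
  u*[v*y]≡y {u} {v} uv≡1 y = trans (sym (*-assoc u v y)) (trans (cong (_* y) uv≡1) (*-identityˡ y))

  module _ {u : K} (u≢0 : u ≢ 0#) where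
    private
      u⁻¹ : K
      u⁻¹ = proj₁ (inverse u u≢0)
      uu⁻¹≡1 : u * u⁻¹ ≡ 1#
      uu⁻¹≡1 = proj₂ (inverse u u≢0)

    ΣK-scale : ∀ f → ΣK f ≡ ΣK (λ t → f (u * t))
    ΣK-scale = ΣK-reindex {σ = u *_} {σ⁻¹ = u⁻¹ *_} (u*[v*y]≡y uu⁻¹≡1) (u*[v*y]≡y (trans (*-comm u⁻¹ u) uu⁻¹≡1))

    ΠK-scale : ∀ f → ΠK f ≡ ΠK (λ t → f (u * t))
    ΠK-scale = ΠK-reindex {σ = u *_} {σ⁻¹ = u⁻¹ *_} (u*[v*y]≡y uu⁻¹≡1) (u*[v*y]≡y (trans (*-comm u⁻¹ u) uu⁻¹≡1))

  orOne : K → K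
  orOne y with y ≟ 0#
  ... | yes _ = 1#
  ... | no  _ = y

  orOne-nonzero : ∀ y → orOne y ≢ 0#
  orOne-nonzero y with y ≟ 0#
  ... | yes _   = λ 1≡0 → 0≢1 (sym 1≡0)
  ... | no  y≢0 = y≢0

  module _ {x : K} (x≢0 : x ≢ 0#) where
    private
      scale : K → K
      scale y with y ≟ 0#
      ... | yes _ = 1#
      ... | no  _ = x

      scale-0 : scale 0# ≡ 1#
      scale-0 with 0# ≟ 0#
      ... | yes _   = refl
      ... | no  0≢0 = ⊥-elim (0≢0 refl)

      scale-nonzero : ∀ i → i ≢ index 0# → scale (enum i) ≡ x
      scale-nonzero i i≢0 with enum i ≟ 0#
      ... | yes i≡0 = ⊥-elim (i≢0 (trans (sym (index-enum i)) (cong index i≡0)))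
      ... | no  _   = refl

      orOne-* : ∀ y → orOne (x * y) ≡ scale y * orOne y
      orOne-* y with y ≟ 0# | x * y ≟ 0#
      ... | yes _   | yes _    = sym (*-identityˡ 1#)
      ... | yes y≡0 | no xy≢0  = ⊥-elim (xy≢0 (trans (cong (x *_) y≡0) (zeroʳ x)))
      ... | no  y≢0 | yes xy≡0 = ⊥-elim (*-nonzero x≢0 y≢0 xy≡0)
      ... | no  _   | no  _    = refl

      -- Multiplication by x permutes K, so ∏ orOne = ∏ (orOne ∘ (x *_)) = ∏ scale * ∏ orOne.
      ΠK-scale≡1 : ΠK scale ≡ 1#
      ΠK-scale≡1 = *-cancelˡ (prod-nonzero q (orOne ∘ enum) (orOne-nonzero ∘ enum)) (begin
        ΠK orOne * ΠK scale          ≡⟨ *-comm _ _ ⟩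
        ΠK scale * ΠK orOne          ≡⟨ sym (prod-distrib-* (scale ∘ enum) (orOne ∘ enum)) ⟩
        ΠK (λ y → scale y * orOne y) ≡⟨ prod-cong-≗ (λ i → sym (orOne-* (enum i))) ⟩
        ΠK (orOne ∘ (x *_))          ≡⟨ sym (ΠK-scale x≢0 orOne) ⟩
        ΠK orOne                     ≡⟨ sym (*-identityʳ _) ⟩
        ΠK orOne * 1#                ∎)

    fermat-nonzero : x ^ p ≡ 1#
    fermat-nonzero = *-cancelˡ x≢0 (begin
      x * x ^ p     ≡⟨ cong (x ^_) (sym q≡1+p) ⟩
      x ^ q         ≡⟨ sym (prod-constExcept q (scale ∘ enum) (index 0#) (trans (cong scale (enum-index 0#)) scale-0) scale-nonzero) ⟩
      ΠK scale * x  ≡⟨ cong (_* x) ΠK-scale≡1 ⟩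
      1# * x        ≡⟨ *-comm 1# x ⟩
      x * 1#        ∎)

  fermat : ∀ x → x ^ q ≡ x
  fermat x with x ≟ 0#
  ... | yes x≡0 = trans (cong (_^ q) x≡0) (trans (0^n≡0 (subst (1 ℕ.≤_) (sym q≡1+p) (s≤s z≤n))) (sym x≡0))
  ... | no  x≢0 = trans (cong (x ^_) q≡1+p) (trans (cong (x *_) (fermat-nonzero x≢0)) (*-identityʳ x))

  square-+ : ∀ x y → (x + y) ^ 2 ≡ x ^ 2 + y ^ 2
  square-+ x y = begin
    (x + y) * ((x + y) * 1#)           ≡⟨ cong ((x + y) *_) (*-identityʳ _) ⟩
    (x + y) * (x + y)                  ≡⟨ distribʳ _ _ _ ⟩
    x * (x + y) + y * (x + y)          ≡⟨ cong₂ _+_ (distribˡ x x y) (distribˡ y x y) ⟩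
    (x * x + x * y) + (y * x + y * y)  ≡⟨ cong (λ u → (x * x + x * y) + (u + y * y)) (*-comm y x) ⟩
    (x * x + x * y) + (x * y + y * y)  ≡⟨ solve 3 (λ a b c → ((a ⊕ b) ⊕ (b ⊕ c)) ⊜ ((a ⊕ c) ⊕ (b ⊕ b))) refl (x * x) (x * y) (y * y) ⟩
    (x * x + y * y) + (x * y + x * y)  ≡⟨ cong (x * x + y * y +_) (x+x≡0 (x * y)) ⟩
    (x * x + y * y) + 0#               ≡⟨ +-identityʳ _ ⟩
    x * x + y * y                      ≡⟨ sym (cong₂ _+_ (cong (x *_) (*-identityʳ x)) (cong (y *_) (*-identityʳ y))) ⟩
    x * (x * 1#) + y * (y * 1#)        ∎

  frobenius-+ : ∀ t x y → (x + y) ^ (2 ℕ.^ t) ≡ x ^ (2 ℕ.^ t) + y ^ (2 ℕ.^ t)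
  frobenius-+ zero    x y = distribʳ 1# x y
  frobenius-+ (suc t) x y = begin
    (x + y) ^ (2 ℕ.* 2 ℕ.^ t)                  ≡⟨ sym (^-assocʳ (x + y) 2 (2 ℕ.^ t)) ⟩
    ((x + y) ^ 2) ^ (2 ℕ.^ t)                  ≡⟨ cong (_^ (2 ℕ.^ t)) (square-+ x y) ⟩
    (x ^ 2 + y ^ 2) ^ (2 ℕ.^ t)                ≡⟨ frobenius-+ t (x ^ 2) (y ^ 2) ⟩
    (x ^ 2) ^ (2 ℕ.^ t) + (y ^ 2) ^ (2 ℕ.^ t)  ≡⟨ cong₂ _+_ (^-assocʳ x 2 (2 ℕ.^ t)) (^-assocʳ y 2 (2 ℕ.^ t)) ⟩
    x ^ (2 ℕ.* 2 ℕ.^ t) + y ^ (2 ℕ.* 2 ℕ.^ t)  ∎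

  frobenius-root : ∀ h x → (x ^ (h ℕ.* 2)) ^ (2 ℕ.^ m) ≡ x ^ h
  frobenius-root h x = begin
    (x ^ (h ℕ.* 2)) ^ (2 ℕ.^ m)   ≡⟨ ^-assocʳ x (h ℕ.* 2) (2 ℕ.^ m) ⟩
    x ^ ((h ℕ.* 2) ℕ.* 2 ℕ.^ m)   ≡⟨ cong (x ^_) (ℕP.*-assoc h 2 (2 ℕ.^ m)) ⟩
    x ^ (h ℕ.* q)                 ≡⟨ sym (^-assocʳ x h q) ⟩
    (x ^ h) ^ q                   ≡⟨ fermat (x ^ h) ⟩
    x ^ h                         ∎

  -- Polynomials and power sums

  δ : ℕ → ℕ → K
  δ i j with j ℕ.≟ i
  ... | yes _ = 1#
  ... | no  _ = 0#

  δ-diag : ∀ i → δ i i ≡ 1#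
  δ-diag i with i ℕ.≟ i
  ... | yes _   = refl
  ... | no  i≢i = ⊥-elim (i≢i refl)

  δ-off : ∀ {i j} → j ≢ i → δ i j ≡ 0#
  δ-off {i} {j} j≢i with j ℕ.≟ i
  ... | yes j≡i = ⊥-elim (j≢i j≡i)
  ... | no  _   = refl

  δ≢0⇒≡ : ∀ {i j} → δ i j ≢ 0# → j ≡ i
  δ≢0⇒≡ {i} {j} δ≢0 with j ℕ.≟ i
  ... | yes j≡i = j≡i
  ... | no  _   = ⊥-elim (δ≢0 refl)

  poly : (N : ℕ) → (Fin N → K) → K → K
  poly N c x = Σ< N (λ j → c j * x ^ toℕ j)

  poly-suc : ∀ N c x → poly (suc N) c x ≡ c Fin.zero + x * poly N (c ∘ Fin.suc) x
  poly-suc N c x = cong₂ _+_ (*-identityʳ _) (begin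
    Σ< N (λ j → c (Fin.suc j) * (x * x ^ toℕ j)) ≡⟨ Σ-cong N (λ j → x*[y*z]≡y*[x*z] (c (Fin.suc j)) x _) ⟩
    Σ< N (λ j → x * (c (Fin.suc j) * x ^ toℕ j)) ≡⟨ sym (Σ-*ˡ N x _) ⟩
    x * poly N (c ∘ Fin.suc) x                  ∎)

  poly-+ : ∀ N c d x → poly N (λ j → c j + d j) x ≡ poly N c x + poly N d x
  poly-+ N c d x = trans (Σ-cong N (λ j → distribʳ (x ^ toℕ j) (c j) (d j))) (Σ-+ N _ _)

  poly-monomial : ∀ N k → k ℕ.< N → ∀ x → poly N (δ k ∘ toℕ) x ≡ x ^ k
  poly-monomial N k k<N x = begin
    poly N (δ k ∘ toℕ) x       ≡⟨ Σ-single N _ (Fin.fromℕ< k<N) off ⟩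
    δ k (toℕ (Fin.fromℕ< k<N)) * x ^ toℕ (Fin.fromℕ< k<N) ≡⟨ cong (λ j → δ k j * x ^ j) (FinP.toℕ-fromℕ< k<N) ⟩
    δ k k * x ^ k              ≡⟨ cong (_* x ^ k) (δ-diag k) ⟩
    1# * x ^ k                 ≡⟨ *-identityˡ _ ⟩
    x ^ k                      ∎
    where
    off : ∀ j → j ≢ Fin.fromℕ< k<N → δ k (toℕ j) * x ^ toℕ j ≡ 0#
    off j j≢k = trans (cong (_* _) (δ-off (j≢k ∘ FinP.toℕ-injective ∘ flip trans (sym (FinP.toℕ-fromℕ< k<N))))) (zeroˡ _)

  -- Synthetic division by X + r, which is X − r in characteristic 2.
  divide : ∀ N → (Fin (suc N) → K) → K → Fin N → K
  divide (suc N) c r Fin.zero    = poly (suc N) (c ∘ Fin.suc) r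
  divide (suc N) c r (Fin.suc j) = divide N (c ∘ Fin.suc) r j

  divide-spec : ∀ N c r x → poly (suc N) c x ≡ (x + r) * poly N (divide N c r) x + poly (suc N) c r
  divide-spec zero c r x = begin
    poly 1 c x               ≡⟨ poly-suc 0 c x ⟩
    c Fin.zero + x * 0#      ≡⟨ cong (c Fin.zero +_) (trans (zeroʳ x) (sym (zeroʳ r))) ⟩
    c Fin.zero + r * 0#      ≡⟨ sym (poly-suc 0 c r) ⟩
    poly 1 c r               ≡⟨ sym (+-identityˡ _) ⟩
    0# + poly 1 c r          ≡⟨ cong (_+ poly 1 c r) (sym (zeroʳ (x + r))) ⟩
    (x + r) * 0# + poly 1 c r ∎
  divide-spec (suc N) c r x = begin
    poly (suc (suc N)) c x                          ≡⟨ poly-suc (suc N) c x ⟩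
    c₀ + x * poly (suc N) c₁ x                      ≡⟨ cong (λ u → c₀ + x * u) (divide-spec N c₁ r x) ⟩
    c₀ + x * ((x + r) * Q + P)                      ≡⟨ sym (+-identityʳ _) ⟩
    (c₀ + x * ((x + r) * Q + P)) + 0#               ≡⟨ cong (c₀ + x * ((x + r) * Q + P) +_) (sym (x+x≡0 (r * P))) ⟩
    (c₀ + x * ((x + r) * Q + P)) + (r * P + r * P)  ≡⟨ sym (solve 5 (λ x r P Q c₀ →
                                                         ((x ⊕ r) ⊗ (P ⊕ x ⊗ Q) ⊕ (c₀ ⊕ r ⊗ P))
                                                           ⊜ ((c₀ ⊕ x ⊗ ((x ⊕ r) ⊗ Q ⊕ P)) ⊕ (r ⊗ P ⊕ r ⊗ P)))
                                                         refl x r P Q c₀) ⟩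
    (x + r) * (P + x * Q) + (c₀ + r * P)
      ≡⟨ sym (cong₂ (λ u v → (x + r) * u + v) (poly-suc N (divide (suc N) c r) x) (poly-suc (suc N) c r)) ⟩
    (x + r) * poly (suc N) (divide (suc N) c r) x + poly (suc (suc N)) c r ∎
    where
    c₀ : K
    c₀ = c Fin.zero
    c₁ : Fin (suc N) → K
    c₁ = c ∘ Fin.suc
    Q P : K
    Q = poly N (divide N c₁ r) x
    P = poly (suc N) c₁ r

  divide≡0⇒≡0 : ∀ N c r → (∀ j → divide N c r j ≡ 0#) → poly (suc N) c r ≡ 0# → ∀ j → c j ≡ 0#
  divide≡0⇒≡0 N c r quot≡0 rem≡0 Fin.zero = begin
    c Fin.zero                               ≡⟨ sym (+-identityʳ _) ⟩
    c Fin.zero + 0#                          ≡⟨ cong (c Fin.zero +_) (sym (trans (cong (r *_) (tail≡0 N c quot≡0)) (zeroʳ r))) ⟩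
    c Fin.zero + r * poly N (c ∘ Fin.suc) r  ≡⟨ sym (poly-suc N c r) ⟩
    poly (suc N) c r                         ≡⟨ rem≡0 ⟩
    0#                                       ∎
    where
    tail≡0 : ∀ N (c : Fin (suc N) → K) → (∀ j → divide N c r j ≡ 0#) → poly N (c ∘ Fin.suc) r ≡ 0#
    tail≡0 zero    _ _      = refl
    tail≡0 (suc N) _ quot≡0 = quot≡0 Fin.zero
  divide≡0⇒≡0 zero    c r _      _ (Fin.suc ())
  divide≡0⇒≡0 (suc N) c r quot≡0 _ (Fin.suc j) =
    divide≡0⇒≡0 N (c ∘ Fin.suc) r (quot≡0 ∘ Fin.suc) (quot≡0 Fin.zero) j

  roots⇒≡0 : ∀ N (c r : Fin N → K) → (∀ {i j} → r i ≡ r j → i ≡ j) →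
             (∀ i → poly N c (r i) ≡ 0#) → ∀ j → c j ≡ 0#
  roots⇒≡0 zero    c r _     _     ()
  roots⇒≡0 (suc N) c r r-inj roots = divide≡0⇒≡0 N c r₀ quot≡0 (roots Fin.zero)
    where
    r₀ : K
    r₀ = r Fin.zero
    quot≡0 : ∀ j → divide N c r₀ j ≡ 0#
    quot≡0 = roots⇒≡0 N (divide N c r₀) (r ∘ Fin.suc) (FinP.suc-injective ∘ r-inj) quot-roots
      where
      quot-roots : ∀ i → poly N (divide N c r₀) (r (Fin.suc i)) ≡ 0#
      quot-roots i = x*y≡0⇒y≡0 x+r₀≢0 (begin
        (x + r₀) * poly N (divide N c r₀) x        ≡⟨ sym (+-identityʳ _) ⟩
        (x + r₀) * poly N (divide N c r₀) x + 0#   ≡⟨ cong ((x + r₀) * poly N (divide N c r₀) x +_) (sym (roots Fin.zero)) ⟩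
        (x + r₀) * poly N (divide N c r₀) x + poly (suc N) c r₀ ≡⟨ sym (divide-spec N c r₀ x) ⟩
        poly (suc N) c x                           ≡⟨ roots (Fin.suc i) ⟩
        0#                                         ∎)
        where
        x : K
        x = r (Fin.suc i)
        x+r₀≢0 : x + r₀ ≢ 0#
        x+r₀≢0 x+r₀≡0 with r-inj (x+y≡0⇒x≡y x+r₀≡0)
        ... | ()

  ^-periodic : ∀ x {l} → 1 ℕ.≤ l → x ^ (p ℕ.+ l) ≡ x ^ l
  ^-periodic x {l} 1≤l with x ≟ 0#
  ... | yes x≡0 = begin
    x ^ (p ℕ.+ l)  ≡⟨ cong (_^ (p ℕ.+ l)) x≡0 ⟩
    0# ^ (p ℕ.+ l) ≡⟨ 0^n≡0 (ℕP.≤-trans 1≤l (ℕP.m≤n+m l p)) ⟩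
    0#             ≡⟨ sym (0^n≡0 1≤l) ⟩
    0# ^ l         ≡⟨ cong (_^ l) (sym x≡0) ⟩
    x ^ l          ∎
  ... | no  x≢0 = trans (^-homo-* x p l) (trans (cong (_* x ^ l) (fermat-nonzero x≢0)) (*-identityˡ _))

  indicator : K → K → K
  indicator a x with x ≟ a
  ... | yes _ = 1#
  ... | no  _ = 0#

  indicator-diag : ∀ a → indicator a a ≡ 1#
  indicator-diag a with a ≟ a
  ... | yes _   = refl
  ... | no  a≢a = ⊥-elim (a≢a refl)

  indicator-off : ∀ {a x} → x ≢ a → indicator a x ≡ 0#
  indicator-off {a} {x} x≢a with x ≟ a
  ... | yes x≡a = ⊥-elim (x≢a x≡a)
  ... | no  _   = refl

  ΣK-indicator : ∀ a (f : K → K) → ΣK (λ t → f t * indicator a t) ≡ f a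
  ΣK-indicator a f = begin
    ΣK (λ t → f t * indicator a t)                     ≡⟨ Σ-single q _ (index a) off ⟩
    f (enum (index a)) * indicator a (enum (index a))  ≡⟨ cong (λ t → f t * indicator a t) (enum-index a) ⟩
    f a * indicator a a                                ≡⟨ cong (f a *_) (indicator-diag a) ⟩
    f a * 1#                                           ≡⟨ *-identityʳ (f a) ⟩
    f a                                                ∎
    where
    off : ∀ j → j ≢ index a → f (enum j) * indicator a (enum j) ≡ 0#
    off j j≢a = trans (cong (f (enum j) *_) (indicator-off (j≢a ∘ trans (sym (index-enum j)) ∘ cong index))) (zeroʳ _)

  x^p+1≡indicator : ∀ x → x ^ p + 1# ≡ indicator 0# x
  x^p+1≡indicator x with x ≟ 0#
  ... | yes x≡0 = trans (cong (_+ 1#) (trans (cong (_^ p) x≡0) (0^n≡0 1≤p))) (+-identityˡ 1#)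
  ... | no  x≢0 = trans (cong (_+ 1#) (fermat-nonzero x≢0)) 1+1≡0

  powerSum : ℕ → K
  powerSum l = ΣK (_^ l)

  powerSum-0 : powerSum 0 ≡ 0#
  powerSum-0 = trans (Σ<≡sum q _) (trans (sum-replicate q) q·1≡0)

  powerSum-p : powerSum p ≡ 1#
  powerSum-p = begin
    powerSum p                       ≡⟨ sym (+-identityʳ _) ⟩
    powerSum p + 0#                  ≡⟨ cong (powerSum p +_) (sym powerSum-0) ⟩
    powerSum p + powerSum 0          ≡⟨ sym (Σ-+ q _ _) ⟩
    ΣK (λ t → t ^ p + 1#)            ≡⟨ Σ-cong q (λ i → trans (x^p+1≡indicator (enum i)) (sym (*-identityˡ _))) ⟩
    ΣK (λ t → 1# * indicator 0# t)   ≡⟨ ΣK-indicator 0# (λ _ → 1#) ⟩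
    1#                               ∎

  powerSum-periodic : ∀ {l} → 1 ℕ.≤ l → powerSum (p ℕ.+ l) ≡ powerSum l
  powerSum-periodic 1≤l = Σ-cong q (λ i → ^-periodic (enum i) 1≤l)

  powerSum-vanishes : ∀ {l u} → u ≢ 0# → u ^ l ≢ 1# → powerSum l ≡ 0#
  powerSum-vanishes {l} {u} u≢0 u^l≢1 = x*y≡0⇒y≡0 (u^l≢1 ∘ x+y≡0⇒x≡y) (begin
    (u ^ l + 1#) * powerSum l               ≡⟨ distribʳ _ _ _ ⟩
    u ^ l * powerSum l + 1# * powerSum l    ≡⟨ cong₂ _+_ (Σ-*ˡ q (u ^ l) _) (*-identityˡ _) ⟩
    ΣK (λ t → u ^ l * t ^ l) + powerSum l   ≡⟨ cong (_+ powerSum l) (Σ-cong q (λ i → sym (^-distrib-* u (enum i) l))) ⟩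
    ΣK (λ t → (u * t) ^ l) + powerSum l     ≡⟨ cong (_+ powerSum l) (sym (ΣK-scale u≢0 (_^ l))) ⟩
    powerSum l + powerSum l                 ≡⟨ x+x≡0 _ ⟩
    0#                                      ∎)

  -- Otherwise X^(l+1) + X, of degree l + 1 < q, would vanish on all of K.
  not-all-roots : ∀ {l} → 1 ℕ.≤ l → l ℕ.< p → ¬ (∀ i → enum i ≡ 0# ⊎ enum i ^ l ≡ 1#)
  not-all-roots {l} 1≤l l<p all-roots = 0≢1 (begin
    0#                        ≡⟨ sym c₁≡0 ⟩
    c (Fin.suc Fin.zero)      ≡⟨ cong₂ _+_ (δ-diag 1) (δ-off (ℕP.<⇒≢ (s≤s 1≤l))) ⟩
    1# + 0#                   ≡⟨ +-identityʳ 1# ⟩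
    1#                        ∎)
    where
    l+2≤q : suc (suc l) ℕ.≤ q
    l+2≤q = subst (suc (suc l) ℕ.≤_) (sym q≡1+p) (s≤s l<p)
    c : Fin (suc (suc l)) → K
    c j = δ 1 (toℕ j) + δ (suc l) (toℕ j)
    c-root : ∀ {x} → x ≡ 0# ⊎ x ^ l ≡ 1# → poly (suc (suc l)) c x ≡ 0#
    c-root {x} root = begin
      poly (suc (suc l)) c x   ≡⟨ poly-+ (suc (suc l)) (δ 1 ∘ toℕ) (δ (suc l) ∘ toℕ) x ⟩
      poly (suc (suc l)) (δ 1 ∘ toℕ) x + poly (suc (suc l)) (δ (suc l) ∘ toℕ) x
        ≡⟨ cong₂ _+_ (poly-monomial (suc (suc l)) 1 (s≤s (s≤s z≤n)) x) (poly-monomial (suc (suc l)) (suc l) ℕP.≤-refl x) ⟩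
      x * 1# + x * x ^ l       ≡⟨ vanish root ⟩
      0#                       ∎
      where
      vanish : x ≡ 0# ⊎ x ^ l ≡ 1# → x * 1# + x * x ^ l ≡ 0#
      vanish (inj₁ x≡0) = trans (cong (λ y → y * 1# + y * y ^ l) x≡0)
                                (trans (cong₂ _+_ (zeroˡ 1#) (zeroˡ _)) (+-identityˡ 0#))
      vanish (inj₂ x^l≡1) = trans (cong (λ y → x * 1# + x * y) x^l≡1) (x+x≡0 _)
    c₁≡0 : c (Fin.suc Fin.zero) ≡ 0#
    c₁≡0 = roots⇒≡0 (suc (suc l)) c (λ j → enum (Fin.inject≤ j l+2≤q))
                    (FinP.inject≤-injective l+2≤q l+2≤q _ _ ∘ enum-injective)
                    (λ j → c-root (all-roots (Fin.inject≤ j l+2≤q))) (Fin.suc Fin.zero)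

  powerSum-below-p : ∀ {l} → 1 ℕ.≤ l → l ℕ.< p → powerSum l ≡ 0#
  powerSum-below-p {l} 1≤l l<p =
    vanish (FinP.¬∀⟶∃¬ q _ (λ i → (enum i ≟ 0#) ⊎-dec (enum i ^ l ≟ 1#)) (not-all-roots 1≤l l<p))
    where
    vanish : ∃[ i ] ¬ (enum i ≡ 0# ⊎ enum i ^ l ≡ 1#) → powerSum l ≡ 0#
    vanish (_ , ¬root) = powerSum-vanishes {l} (¬root ∘ inj₁) (¬root ∘ inj₂)

  powerSum-zero : ∀ l → l ≢ p → l ℕ.< p ℕ.+ p → powerSum l ≡ 0#
  powerSum-zero zero    _   _ = powerSum-0
  powerSum-zero (suc l) l≢p l<2p with ℕP.<-cmp (suc l) p
  ... | tri< l<p _ _ = powerSum-below-p (s≤s z≤n) l<p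
  ... | tri≈ _ l≡p _ = ⊥-elim (l≢p l≡p)
  ... | tri> _ _ p<l = begin
    powerSum (suc l)           ≡⟨ cong powerSum (sym p+l′≡1+l) ⟩
    powerSum (p ℕ.+ l′)        ≡⟨ powerSum-periodic 1≤l′ ⟩
    powerSum l′                ≡⟨ powerSum-below-p 1≤l′ (ℕP.+-cancelˡ-< p l′ p (subst (ℕ._< p ℕ.+ p) (sym p+l′≡1+l) l<2p)) ⟩
    0#                         ∎
    where
    l′ : ℕ
    l′ = suc l ℕ.∸ p
    1≤l′ : 1 ℕ.≤ l′
    1≤l′ = ℕP.m<n⇒0<n∸m p<l
    p+l′≡1+l : p ℕ.+ l′ ≡ suc l
    p+l′≡1+l = ℕP.m+[n∸m]≡n (ℕP.<⇒≤ p<l)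

  -- Degree through derivatives

  Δ : K → (K → K) → K → K
  Δ b G x = G (x + b) + G x

  DegreeAtMost : ℕ → (K → K) → Set a
  DegreeAtMost zero    G = ∀ x → G x ≡ G 0#
  DegreeAtMost (suc k) G = ∀ b → DegreeAtMost k (Δ b G)

  IsAffine : (K → K) → Set a
  IsAffine A = ∀ x y → A (x + y) + A 0# ≡ A x + A y

  additive⇒affine : ∀ {B} → (∀ x y → B (x + y) ≡ B x + B y) → IsAffine B
  additive⇒affine {B} additive x y = trans (cong (B (x + y) +_) B0≡0) (trans (+-identityʳ _) (additive x y))
    where
    B0≡0 : B 0# ≡ 0#
    B0≡0 = identityʳ-unique (B 0#) (B 0#) (sym (trans (cong B (sym (+-identityʳ 0#))) (additive 0# 0#)))

  affine-id : IsAffine (λ x → x)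
  affine-id = additive⇒affine (λ _ _ → refl)

  affine-split : ∀ {A} → IsAffine A → ∀ x y → A (x + y) ≡ (A x + A y) + A 0#
  affine-split {A} A-aff x y = begin
    A (x + y)                    ≡⟨ sym (+-identityʳ _) ⟩
    A (x + y) + 0#               ≡⟨ cong (A (x + y) +_) (sym (x+x≡0 (A 0#))) ⟩
    A (x + y) + (A 0# + A 0#)    ≡⟨ sym (+-assoc _ _ _) ⟩
    (A (x + y) + A 0#) + A 0#    ≡⟨ cong (_+ A 0#) (A-aff x y) ⟩
    (A x + A y) + A 0#           ∎

  affine-∘ : ∀ {f g} → IsAffine f → IsAffine g → IsAffine (f ∘ g)
  affine-∘ {f} {g} f-aff g-aff x y = begin
    f (g (x + y)) + f (g 0#)                              ≡⟨ cong (λ u → f u + f (g 0#)) (affine-split g-aff x y) ⟩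
    f ((g x + g y) + g 0#) + f (g 0#)                     ≡⟨ cong (_+ f (g 0#)) (affine-split f-aff _ _) ⟩
    ((f (g x + g y) + f (g 0#)) + f 0#) + f (g 0#)
      ≡⟨ solve 3 (λ u v w → (((u ⊕ v) ⊕ w) ⊕ v) ⊜ ((u ⊕ w) ⊕ (v ⊕ v))) refl (f (g x + g y)) (f (g 0#)) (f 0#) ⟩
    (f (g x + g y) + f 0#) + (f (g 0#) + f (g 0#))        ≡⟨ x+y+[z+z]≡x+y _ _ _ ⟩
    f (g x + g y) + f 0#                                  ≡⟨ f-aff (g x) (g y) ⟩
    f (g x) + f (g y)                                     ∎

  affine⇒shift-additive : ∀ {B} → IsAffine B → ∀ x y → B (x + y) + B 0# ≡ (B x + B 0#) + (B y + B 0#)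
  affine⇒shift-additive B-aff x y = trans (B-aff x y) (sym (trans (+-interchange _ _ _ _) (x+y+[z+z]≡x+y _ _ _)))

  frobenius-affine : ∀ t → IsAffine (_^ (2 ℕ.^ t))
  frobenius-affine t = additive⇒affine (frobenius-+ t)

  deg≤-resp : ∀ k {G H} → (∀ x → G x ≡ H x) → DegreeAtMost k G → DegreeAtMost k H
  deg≤-resp zero    G≗H G≤k x = trans (sym (G≗H x)) (trans (G≤k x) (G≗H 0#))
  deg≤-resp (suc k) G≗H G≤k b = deg≤-resp k (λ x → cong₂ _+_ (G≗H (x + b)) (G≗H x)) (G≤k b)

  deg≤-const : ∀ k c → DegreeAtMost k (λ _ → c)
  deg≤-const zero    c _ = refl
  deg≤-const (suc k) c _ = deg≤-resp k (λ _ → sym (x+x≡0 c)) (deg≤-const k 0#)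

  deg≤-suc : ∀ k {G} → DegreeAtMost k G → DegreeAtMost (suc k) G
  deg≤-suc zero    G≤0 b = deg≤-resp 0 (λ x → sym (trans (cong₂ _+_ (G≤0 (x + b)) (G≤0 x)) (x+x≡0 _))) (deg≤-const 0 0#)
  deg≤-suc (suc k) G≤k b = deg≤-suc k (G≤k b)

  deg≤-mono : ∀ {k l G} → k ℕ.≤ l → DegreeAtMost k G → DegreeAtMost l G
  deg≤-mono {l = zero}  z≤n G≤k = G≤k
  deg≤-mono {l = suc l} k≤l G≤k with ℕP.m≤n⇒m<n∨m≡n k≤l
  ... | inj₁ k<l  = deg≤-suc l (deg≤-mono (ℕP.≤-pred k<l) G≤k)
  ... | inj₂ refl = G≤k

  deg≤-+ : ∀ k {G H} → DegreeAtMost k G → DegreeAtMost k H → DegreeAtMost k (λ x → G x + H x)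
  deg≤-+ zero    G≤0 H≤0 x = cong₂ _+_ (G≤0 x) (H≤0 x)
  deg≤-+ (suc k) G≤k H≤k b = deg≤-resp k (λ _ → +-interchange _ _ _ _) (deg≤-+ k (G≤k b) (H≤k b))

  deg≤-Σ : ∀ k n (G : Fin n → K → K) → (∀ i → DegreeAtMost k (G i)) → DegreeAtMost k (λ x → Σ< n (λ i → G i x))
  deg≤-Σ k zero    G _    = deg≤-const k 0#
  deg≤-Σ k (suc n) G G≤k = deg≤-+ k (G≤k Fin.zero) (deg≤-Σ k n (G ∘ Fin.suc) (G≤k ∘ Fin.suc))

  deg≤-affine∘ : ∀ k {B G} → IsAffine B → DegreeAtMost k G → DegreeAtMost k (B ∘ G)
  deg≤-affine∘ zero    {B} _     G≤0 x = cong B (G≤0 x)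
  deg≤-affine∘ (suc k) {B} {G} B-aff G≤k b = deg≤-resp k (λ x → B-aff (G (x + b)) (G x)) (deg≤-affine∘ k B′-aff (G≤k b))
    where
    B′-aff : IsAffine (λ u → B u + B 0#)
    B′-aff = additive⇒affine (affine⇒shift-additive B-aff)

  deg≤-∘affine : ∀ k {B G} → IsAffine B → DegreeAtMost k G → DegreeAtMost k (G ∘ B)
  deg≤-∘affine zero    {B} _     G≤0 x = trans (G≤0 (B x)) (sym (G≤0 (B 0#)))
  deg≤-∘affine (suc k) {B} {G} B-aff G≤k b = deg≤-resp k shift (deg≤-∘affine k B-aff (G≤k (B b + B 0#)))
    where
    shift : ∀ x → Δ (B b + B 0#) G (B x) ≡ Δ b (G ∘ B) x
    shift x = cong (λ u → G u + G (B x)) (begin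
      B x + (B b + B 0#)         ≡⟨ sym (+-assoc _ _ _) ⟩
      (B x + B b) + B 0#         ≡⟨ cong (_+ B 0#) (sym (B-aff x b)) ⟩
      (B (x + b) + B 0#) + B 0#  ≡⟨ +-assoc _ _ _ ⟩
      B (x + b) + (B 0# + B 0#)  ≡⟨ cong (B (x + b) +_) (x+x≡0 _) ⟩
      B (x + b) + 0#             ≡⟨ +-identityʳ _ ⟩
      B (x + b)                  ∎)

  affine-*ˡ : ∀ c → IsAffine (c *_)
  affine-*ˡ c x y = trans (cong (c * (x + y) +_) (zeroʳ c)) (trans (+-identityʳ _) (distribˡ c x y))

  deg≤-scale : ∀ k c {G} → DegreeAtMost k G → DegreeAtMost k (λ x → c * G x)
  deg≤-scale k c = deg≤-affine∘ k (affine-*ˡ c)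

  affine⇒deg≤1 : ∀ {A} → IsAffine A → DegreeAtMost 1 A
  affine⇒deg≤1 {A} A-aff b = deg≤-resp 0 Δ-const (deg≤-const 0 (A b + A 0#))
    where
    Δ-const : ∀ x → A b + A 0# ≡ A (x + b) + A x
    Δ-const x = begin
      A b + A 0#                         ≡⟨ sym (x+[x+y]≡y (A x) _) ⟩
      A x + (A x + (A b + A 0#))         ≡⟨ cong (A x +_) (sym (+-assoc _ _ _)) ⟩
      A x + ((A x + A b) + A 0#)         ≡⟨ cong (λ u → A x + (u + A 0#)) (sym (A-aff x b)) ⟩
      A x + ((A (x + b) + A 0#) + A 0#)  ≡⟨ cong (A x +_) (trans (+-assoc _ _ _) (trans (cong (A (x + b) +_) (x+x≡0 _)) (+-identityʳ _))) ⟩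
      A x + A (x + b)                    ≡⟨ +-comm _ _ ⟩
      A (x + b) + A x                    ∎

  affine-+const : ∀ b → IsAffine (_+ b)
  affine-+const b x y = begin
    (x + y) + b + (0# + b)  ≡⟨ cong ((x + y) + b +_) (+-identityˡ b) ⟩
    (x + y) + b + b         ≡⟨ solve 3 (λ x y b → (((x ⊕ y) ⊕ b) ⊕ b) ⊜ ((x ⊕ b) ⊕ (y ⊕ b))) refl x y b ⟩
    (x + b) + (y + b)       ∎

  deg≤-* : ∀ k {f g} → DegreeAtMost 1 f → DegreeAtMost k g → DegreeAtMost (suc k) (λ x → f x * g x)
  deg≤-* k {f} {g} f≤1 g≤k b = deg≤-resp k (λ x → sym (product-rule x)) (deg≤-+ k (shifted k g≤k) constant-times-g)
    where
    product-rule : ∀ x → Δ b (λ x → f x * g x) x ≡ f (x + b) * Δ b g x + Δ b f x * g x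
    product-rule x = begin
      f (x + b) * g (x + b) + f x * g x
        ≡⟨ cong (f (x + b) * g (x + b) +_) (sym (x+[x+y]≡y (f (x + b) * g x) (f x * g x))) ⟩
      f (x + b) * g (x + b) + (f (x + b) * g x + (f (x + b) * g x + f x * g x))
        ≡⟨ sym (+-assoc _ _ _) ⟩
      (f (x + b) * g (x + b) + f (x + b) * g x) + (f (x + b) * g x + f x * g x)
        ≡⟨ sym (cong₂ _+_ (distribˡ (f (x + b)) _ _) (distribʳ (g x) _ _)) ⟩
      f (x + b) * Δ b g x + Δ b f x * g x
        ∎
    shifted : ∀ k → DegreeAtMost k g → DegreeAtMost k (λ x → f (x + b) * Δ b g x)
    shifted zero    g≤0 = deg≤-resp 0 (λ x → sym (trans (cong (f (x + b) *_) (Δ-const x)) (zeroʳ _))) (deg≤-const 0 0#)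
      where
      Δ-const : ∀ x → Δ b g x ≡ 0#
      Δ-const x = trans (cong₂ _+_ (g≤0 (x + b)) (g≤0 x)) (x+x≡0 _)
    shifted (suc k) g≤k = deg≤-* k (deg≤-∘affine 1 (affine-+const b) f≤1) (g≤k b)
    constant-times-g : DegreeAtMost k (λ x → Δ b f x * g x)
    constant-times-g = deg≤-resp k (λ x → cong (_* g x) (sym (f≤1 b x))) (deg≤-scale k (Δ b f 0#) g≤k)

  deg≤-EA : ∀ {k L B A G} → 1 ℕ.≤ k → IsAffine L → IsAffine B → DegreeAtMost 1 A → DegreeAtMost k G →
            DegreeAtMost k (λ x → L (G (B x)) + A x)
  deg≤-EA {k} 1≤k L-aff B-aff A≤1 G≤k = deg≤-+ k (deg≤-affine∘ k L-aff (deg≤-∘affine k B-aff G≤k)) (deg≤-mono 1≤k A≤1)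

  -- Coefficients and binary weights

  -- For 0 < j, Σ_t t^(p-j) t^i is 1 if i = j and 0 otherwise, so this is the x^j-term of G.
  term : ℕ → (K → K) → K → K
  term j G x = ΣK (λ t → t ^ (p ℕ.∸ j) * G (t * x))

  deg≤-term : ∀ k j {G} → DegreeAtMost k G → DegreeAtMost k (term j G)
  deg≤-term k j G≤k = deg≤-Σ k q _ (λ i → deg≤-scale k _ (deg≤-∘affine k (affine-*ˡ (enum i)) G≤k))

  term-poly : ∀ {N} → N ℕ.≤ q → ∀ c {G} → (∀ x → G x ≡ poly N c x) →
              ∀ j → 1 ℕ.≤ toℕ j → ∀ x → term (toℕ j) G x ≡ c j * x ^ toℕ j
  term-poly {N} N≤q c {G} G≡c j 1≤j x = begin
    ΣK (λ t → t ^ e * G (t * x))                               ≡⟨ Σ-cong q (λ i → cong (enum i ^ e *_) (G≡c (enum i * x))) ⟩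
    ΣK (λ t → t ^ e * poly N c (t * x))                        ≡⟨ Σ-cong q (λ i → Σ-*ˡ N (enum i ^ e) _) ⟩
    ΣK (λ t → Σ< N (λ i → t ^ e * (c i * (t * x) ^ toℕ i)))    ≡⟨ Σ-comm q N _ ⟩
    Σ< N (λ i → ΣK (λ t → t ^ e * (c i * (t * x) ^ toℕ i)))    ≡⟨ Σ-cong N (λ i → trans (Σ-cong q (λ l → regroup i (enum l))) (sym (Σ-*ˡ q _ _))) ⟩
    Σ< N (λ i → (c i * x ^ toℕ i) * powerSum (e ℕ.+ toℕ i))    ≡⟨ Σ-single N _ j off ⟩
    (c j * x ^ toℕ j) * powerSum (e ℕ.+ toℕ j)                 ≡⟨ cong (λ l → (c j * x ^ toℕ j) * powerSum l) e+j≡p ⟩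
    (c j * x ^ toℕ j) * powerSum p                             ≡⟨ cong ((c j * x ^ toℕ j) *_) powerSum-p ⟩
    (c j * x ^ toℕ j) * 1#                                     ≡⟨ *-identityʳ _ ⟩
    c j * x ^ toℕ j                                            ∎
    where
    e : ℕ
    e = p ℕ.∸ toℕ j
    i≤p : ∀ (i : Fin N) → toℕ i ℕ.≤ p
    i≤p i = ℕP.≤-pred (subst (toℕ i ℕ.<_) q≡1+p (ℕP.<-≤-trans (FinP.toℕ<n i) N≤q))
    e+j≡p : e ℕ.+ toℕ j ≡ p
    e+j≡p = ℕP.m∸n+n≡m (i≤p j)
    regroup : ∀ i t → t ^ e * (c i * (t * x) ^ toℕ i) ≡ (c i * x ^ toℕ i) * t ^ (e ℕ.+ toℕ i)
    regroup i t = begin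
      t ^ e * (c i * (t * x) ^ toℕ i)             ≡⟨ cong (λ u → t ^ e * (c i * u)) (^-distrib-* t x (toℕ i)) ⟩
      t ^ e * (c i * (t ^ toℕ i * x ^ toℕ i))     ≡⟨ x*[y*z]≡y*[x*z] (t ^ e) (c i) _ ⟩
      c i * (t ^ e * (t ^ toℕ i * x ^ toℕ i))     ≡⟨ cong (c i *_) (trans (sym (*-assoc _ _ _)) (*-comm _ (x ^ toℕ i))) ⟩
      c i * (x ^ toℕ i * (t ^ e * t ^ toℕ i))     ≡⟨ sym (*-assoc (c i) _ _) ⟩
      (c i * x ^ toℕ i) * (t ^ e * t ^ toℕ i)     ≡⟨ cong ((c i * x ^ toℕ i) *_) (sym (^-homo-* t e (toℕ i))) ⟩
      (c i * x ^ toℕ i) * t ^ (e ℕ.+ toℕ i)       ∎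
    off : ∀ i → i ≢ j → (c i * x ^ toℕ i) * powerSum (e ℕ.+ toℕ i) ≡ 0#
    off i i≢j = trans (cong ((c i * x ^ toℕ i) *_) (powerSum-zero _ e+i≢p e+i<2p)) (zeroʳ _)
      where
      e+i≢p : e ℕ.+ toℕ i ≢ p
      e+i≢p e+i≡p = i≢j (FinP.toℕ-injective (ℕP.+-cancelˡ-≡ e _ _ (trans e+i≡p (sym e+j≡p))))
      e+i<2p : e ℕ.+ toℕ i ℕ.< p ℕ.+ p
      e+i<2p = ℕP.+-mono-<-≤ (ℕP.∸-monoʳ-< {p} {toℕ j} {0} 1≤j (i≤p j)) (i≤p i)

  deg≤-monomial : ∀ n → DegreeAtMost (w₂ n) (_^ n)
  deg≤-monomial = halving-ind (λ n → DegreeAtMost (w₂ n) (_^ n)) (deg≤-const 0 1#) even-case odd-case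
    where
    squared : ∀ h → DegreeAtMost (w₂ h) (_^ h) → DegreeAtMost (w₂ h) (_^ (h ℕ.* 2))
    squared h h≤w = deg≤-resp (w₂ h) (λ x → ^-assocʳ x h 2) (deg≤-affine∘ (w₂ h) (frobenius-affine 1) h≤w)
    even-case : ∀ h → (∀ {i} → i ℕ.< suc h ℕ.* 2 → DegreeAtMost (w₂ i) (_^ i)) →
                DegreeAtMost (w₂ (suc h ℕ.* 2)) (_^ (suc h ℕ.* 2))
    even-case h rec = subst (λ w → DegreeAtMost w (_^ (suc h ℕ.* 2))) (sym (w₂-even (suc h))) (squared (suc h) (rec (half<double h)))
    odd-case : ∀ h → (∀ {i} → i ℕ.< suc (h ℕ.* 2) → DegreeAtMost (w₂ i) (_^ i)) →
               DegreeAtMost (w₂ (suc (h ℕ.* 2))) (_^ suc (h ℕ.* 2))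
    odd-case h rec = subst (λ w → DegreeAtMost w (_^ suc (h ℕ.* 2))) (sym (w₂-odd h))
      (deg≤-* (w₂ h) {f = λ x → x} (affine⇒deg≤1 affine-id) (squared h (rec (s≤s (ℕP.m≤m*n h 2)))))

  deg≤-poly : ∀ N k c {G} → (∀ x → G x ≡ poly N c x) → (∀ j → c j ≢ 0# → w₂ (toℕ j) ℕ.≤ k) → DegreeAtMost k G
  deg≤-poly N k c G≡c weights≤k = deg≤-resp k (λ x → sym (G≡c x)) (deg≤-Σ k N (λ j x → c j * x ^ toℕ j) monomial≤k)
    where
    monomial≤k : ∀ j → DegreeAtMost k (λ x → c j * x ^ toℕ j)
    monomial≤k j with c j ≟ 0#
    ... | yes cj≡0 = deg≤-resp k (λ x → sym (trans (cong (_* x ^ toℕ j) cj≡0) (zeroˡ _))) (deg≤-const k 0#)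
    ... | no  cj≢0 = deg≤-scale k (c j) (deg≤-mono (weights≤k j cj≢0) (deg≤-monomial (toℕ j)))

  ^≡^ᴿ : ∀ x n → x ^ n ≡ x ^ᴿ n
  ^≡^ᴿ x zero    = refl
  ^≡^ᴿ x (suc n) = cong (x *_) (^≡^ᴿ x n)

  binomial : ∀ n (x : K) → (x + 1#) ^ n ≡ poly (suc n) (λ k → (n C toℕ k) · 1#) x
  binomial n x = begin
    (x + 1#) ^ n                                    ≡⟨ ^≡^ᴿ (x + 1#) n ⟩
    (x + 1#) ^ᴿ n                                   ≡⟨ BinomialTheorem.theorem n x 1# ⟩
    BinomialTheorem.binomialExpansion x 1# n                    ≡⟨ sum-cong-≗ {suc n} binomialTerm≡ ⟩
    sum {suc n} (λ k → ((n C toℕ k) · 1#) * x ^ toℕ k) ≡⟨ sym (Σ<≡sum (suc n) (λ k → ((n C toℕ k) · 1#) * x ^ toℕ k)) ⟩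
    poly (suc n) (λ k → (n C toℕ k) · 1#) x         ∎
    where
    binomialTerm≡ : ∀ (k : Fin (suc n)) → (n C toℕ k) · (x ^ᴿ toℕ k * 1# ^ᴿ (n ℕ.∸ toℕ k)) ≡ ((n C toℕ k) · 1#) * x ^ toℕ k
    binomialTerm≡ k = begin
      (n C toℕ k) · (x ^ᴿ toℕ k * 1# ^ᴿ (n ℕ.∸ toℕ k))
        ≡⟨ cong ((n C toℕ k) ·_) (cong₂ _*_ (sym (^≡^ᴿ x (toℕ k))) (trans (sym (^≡^ᴿ 1# (n ℕ.∸ toℕ k))) (1^n≡1 (n ℕ.∸ toℕ k)))) ⟩
      (n C toℕ k) · (x ^ toℕ k * 1#)
        ≡⟨ cong ((n C toℕ k) ·_) (trans (*-identityʳ _) (sym (*-identityˡ _))) ⟩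
      (n C toℕ k) · (1# * x ^ toℕ k)
        ≡⟨ sym (×-assoc-* (n C toℕ k) 1# _) ⟩
      ((n C toℕ k) · 1#) * x ^ toℕ k
        ∎

  Δ₁-monomial : ∀ j x → Δ 1# (_^ j) x ≡ poly (suc j) (λ k → (j C toℕ k) · 1# + δ j (toℕ k)) x
  Δ₁-monomial j x = begin
    (x + 1#) ^ j + x ^ j
      ≡⟨ cong₂ _+_ (binomial j x) (sym (poly-monomial (suc j) j ℕP.≤-refl x)) ⟩
    poly (suc j) (λ k → (j C toℕ k) · 1#) x + poly (suc j) (δ j ∘ toℕ) x
      ≡⟨ sym (poly-+ (suc j) (λ k → (j C toℕ k) · 1#) (δ j ∘ toℕ) x) ⟩
    poly (suc j) (λ k → (j C toℕ k) · 1# + δ j (toℕ k)) x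
      ∎

  [1+2h]C[2h]≡1 : ∀ h → (suc (h ℕ.* 2) C (h ℕ.* 2)) · 1# ≡ 1#
  [1+2h]C[2h]≡1 h = begin
    (suc (h ℕ.* 2) C (h ℕ.* 2)) · 1#     ≡⟨ cong (_· 1#) (nCk≡nC[n∸k] (ℕP.n≤1+n (h ℕ.* 2))) ⟩
    (suc (h ℕ.* 2) C (1 ℕ.+ h ℕ.* 2 ℕ.∸ h ℕ.* 2)) · 1#  ≡⟨ cong (λ k → (suc (h ℕ.* 2) C k) · 1#) (ℕP.m+n∸n≡m 1 (h ℕ.* 2)) ⟩
    (suc (h ℕ.* 2) C 1) · 1#             ≡⟨ cong (_· 1#) (nC1≡n (suc (h ℕ.* 2))) ⟩
    1# + (h ℕ.* 2) · 1#                  ≡⟨ cong (1# +_) (×1-homo-* h 2) ⟩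
    1# + (h · 1#) * (1# + (1# + 0#))     ≡⟨ cong (λ u → 1# + (h · 1#) * (1# + u)) (+-identityʳ 1#) ⟩
    1# + (h · 1#) * (1# + 1#)            ≡⟨ cong (λ u → 1# + (h · 1#) * u) 1+1≡0 ⟩
    1# + (h · 1#) * 0#                   ≡⟨ cong (1# +_) (zeroʳ _) ⟩
    1# + 0#                              ≡⟨ +-identityʳ 1# ⟩
    1#                                   ∎

  -- The x^(j-1) coefficient of Δ 1# (_^ j) is j · 1, which is 1 for odd j.
  term-Δ₁-odd-power : ∀ h → suc (suc h ℕ.* 2) ℕ.< q → ∀ x →
                      term (suc h ℕ.* 2) (Δ 1# (_^ suc (suc h ℕ.* 2))) x ≡ x ^ (suc h ℕ.* 2)
  term-Δ₁-odd-power h j<q x = begin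
    term 2h (Δ 1# (_^ j)) x                        ≡⟨ cong (λ l → term l (Δ 1# (_^ j)) x) (sym toℕ-i) ⟩
    term (toℕ i) (Δ 1# (_^ j)) x                   ≡⟨ term-poly j<q c (Δ₁-monomial j) i (subst (1 ℕ.≤_) (sym toℕ-i) (s≤s z≤n)) x ⟩
    ((j C toℕ i) · 1# + δ j (toℕ i)) * x ^ toℕ i  ≡⟨ cong (λ l → ((j C l) · 1# + δ j l) * x ^ l) toℕ-i ⟩
    ((j C 2h) · 1# + δ j 2h) * x ^ 2h              ≡⟨ cong (_* x ^ 2h) (cong₂ _+_ ([1+2h]C[2h]≡1 (suc h)) (δ-off (ℕP.<⇒≢ (ℕP.n<1+n 2h)))) ⟩
    (1# + 0#) * x ^ 2h                             ≡⟨ trans (cong (_* x ^ 2h) (+-identityʳ 1#)) (*-identityˡ (x ^ 2h)) ⟩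
    x ^ 2h                                         ∎
    where
    j 2h : ℕ
    j = suc (suc h ℕ.* 2)
    2h = suc h ℕ.* 2
    c : Fin (suc j) → K
    c k = (j C toℕ k) · 1# + δ j (toℕ k)
    2h<1+j : 2h ℕ.< suc j
    2h<1+j = ℕP.m<n⇒m<1+n (ℕP.n<1+n _)
    i : Fin (suc j)
    i = Fin.fromℕ< 2h<1+j
    toℕ-i : toℕ i ≡ 2h
    toℕ-i = FinP.toℕ-fromℕ< 2h<1+j

  deg≤-monomial⇒w₂≤ : ∀ j → j ℕ.< q → ∀ k → DegreeAtMost k (_^ j) → w₂ j ℕ.≤ k
  deg≤-monomial⇒w₂≤ = halving-ind P (λ _ _ _ → z≤n) even-case odd-case
    where
    P : ℕ → Set a
    P j = j ℕ.< q → ∀ k → DegreeAtMost k (_^ j) → w₂ j ℕ.≤ k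
    even-case : ∀ h → (∀ {i} → i ℕ.< suc h ℕ.* 2 → P i) → P (suc h ℕ.* 2)
    even-case h rec j<q k j≤k =
      subst (ℕ._≤ k) (sym (w₂-even (suc h))) (rec (half<double h) (ℕP.<-trans (half<double h) j<q) k root≤k)
      where
      root≤k : DegreeAtMost k (_^ suc h)
      root≤k = deg≤-resp k (frobenius-root (suc h)) (deg≤-affine∘ k (frobenius-affine m) j≤k)
    odd-case : ∀ h → (∀ {i} → i ℕ.< suc (h ℕ.* 2) → P i) → P (suc (h ℕ.* 2))
    odd-case h rec j<q zero j≤0 = ⊥-elim (0≢1 (begin
      0#                   ≡⟨ sym (0^n≡0 {suc (h ℕ.* 2)} (s≤s z≤n)) ⟩
      0# ^ suc (h ℕ.* 2)   ≡⟨ sym (j≤0 1#) ⟩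
      1# ^ suc (h ℕ.* 2)   ≡⟨ 1^n≡1 (suc (h ℕ.* 2)) ⟩
      1#                   ∎))
    odd-case zero    _   _   (suc k) _   = s≤s z≤n
    odd-case (suc h) rec j<q (suc k) j≤k =
      subst (ℕ._≤ suc k) (sym (w₂-odd (suc h))) (s≤s (subst (ℕ._≤ k) (w₂-even (suc h)) 2h≤k))
      where
      2h≤k : w₂ (suc h ℕ.* 2) ℕ.≤ k
      2h≤k = rec (ℕP.n<1+n _) (ℕP.<-trans (ℕP.n<1+n _) j<q) k
                 (deg≤-resp k (term-Δ₁-odd-power h j<q) (deg≤-term k (suc h ℕ.* 2) (j≤k 1#)))

  deg≤⇒w₂≤ : ∀ {c G} → Represents c G → ∀ k → DegreeAtMost k G → ∀ j → c j ≢ 0# → w₂ (toℕ j) ℕ.≤ k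
  deg≤⇒w₂≤ {c} {G} G≡c k G≤k j cj≢0 with toℕ j ℕ.≟ 0
  ... | yes j≡0 = subst (λ n → w₂ n ℕ.≤ k) (sym j≡0) z≤n
  ... | no  j≢0 = deg≤-monomial⇒w₂≤ (toℕ j) (FinP.toℕ<n j) k
                    (deg≤-resp k normalise (deg≤-scale k cj⁻¹ (deg≤-term k (toℕ j) G≤k)))
    where
    cj⁻¹ : K
    cj⁻¹ = proj₁ (inverse (c j) cj≢0)
    normalise : ∀ x → cj⁻¹ * term (toℕ j) G x ≡ x ^ toℕ j
    normalise x = trans (cong (cj⁻¹ *_) (term-poly ℕP.≤-refl c G≡c j (ℕP.n≢0⇒n>0 j≢0) x))
                        (u*[v*y]≡y (trans (*-comm cj⁻¹ (c j)) (proj₂ (inverse (c j) cj≢0))) _)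

  AlgDeg⇒deg≤ : ∀ {G d} → AlgDeg G d → DegreeAtMost d G
  AlgDeg⇒deg≤ {d = d} (c , G≡c , w≤d , _) = deg≤-poly q d c G≡c w≤d

  AlgDeg-least : ∀ {G d k} → AlgDeg G d → DegreeAtMost k G → d ℕ.≤ k
  AlgDeg-least (_ , _   , _ , inj₁ refl)             _   = z≤n
  AlgDeg-least (c , G≡c , _ , inj₂ (j , cj≢0 , w≡d)) G≤k = subst (ℕ._≤ _) w≡d (deg≤⇒w₂≤ G≡c _ G≤k j cj≢0)

  -- Interpolation

  geometric : ℕ → K → K → K
  geometric zero    x a = 0#
  geometric (suc N) x a = a ^ N + x * geometric N x a

  geometric-telescopes : ∀ N x a → (x + a) * geometric N x a ≡ x ^ N + a ^ N
  geometric-telescopes zero    x a = trans (zeroʳ _) (sym (x+x≡0 1#))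
  geometric-telescopes (suc N) x a = begin
    (x + a) * (a ^ N + x * g)                           ≡⟨ distribˡ (x + a) _ _ ⟩
    (x + a) * a ^ N + (x + a) * (x * g)                 ≡⟨ cong ((x + a) * a ^ N +_) (x*[y*z]≡y*[x*z] (x + a) x g) ⟩
    (x + a) * a ^ N + x * ((x + a) * g)                 ≡⟨ cong (λ u → (x + a) * a ^ N + x * u) (geometric-telescopes N x a) ⟩
    (x + a) * a ^ N + x * (x ^ N + a ^ N)               ≡⟨ cong₂ _+_ (distribʳ (a ^ N) x a) (distribˡ x _ _) ⟩
    (x * a ^ N + a * a ^ N) + (x * x ^ N + x * a ^ N)
      ≡⟨ solve 3 (λ u v w → ((u ⊕ v) ⊕ (w ⊕ u)) ⊜ ((w ⊕ v) ⊕ (u ⊕ u))) refl (x * a ^ N) (a * a ^ N) (x * x ^ N) ⟩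
    (x * x ^ N + a * a ^ N) + (x * a ^ N + x * a ^ N)   ≡⟨ cong (x * x ^ N + a * a ^ N +_) (x+x≡0 _) ⟩
    (x * x ^ N + a * a ^ N) + 0#                        ≡⟨ +-identityʳ _ ⟩
    x ^ suc N + a ^ suc N                               ∎
    where
    g : K
    g = geometric N x a

  geometric-diagonal : ∀ N a → geometric N a a ≡ (N · 1#) * a ^ ℕ.pred N
  geometric-diagonal zero          a = sym (zeroˡ _)
  geometric-diagonal (suc zero)    a = trans (cong (1# +_) (zeroʳ a)) (sym (*-identityʳ (1# + 0#)))
  geometric-diagonal (suc (suc N)) a = begin
    a ^ suc N + a * geometric (suc N) a a                ≡⟨ cong (λ u → a ^ suc N + a * u) (geometric-diagonal (suc N) a) ⟩
    a ^ suc N + a * ((suc N · 1#) * a ^ N)               ≡⟨ cong (a ^ suc N +_) (x*[y*z]≡y*[x*z] a _ _) ⟩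
    a ^ suc N + (suc N · 1#) * a ^ suc N                 ≡⟨ cong (_+ (suc N · 1#) * a ^ suc N) (sym (*-identityˡ _)) ⟩
    1# * a ^ suc N + (suc N · 1#) * a ^ suc N            ≡⟨ sym (distribʳ _ _ _) ⟩
    (suc (suc N) · 1#) * a ^ suc N                       ∎

  geometric-q : ∀ x a → geometric q x a ≡ 1# + indicator x a
  geometric-q x a with a ≟ x
  ... | yes refl = begin
    geometric q a a             ≡⟨ geometric-diagonal q a ⟩
    (q · 1#) * a ^ ℕ.pred q     ≡⟨ cong (_* a ^ ℕ.pred q) q·1≡0 ⟩
    0# * a ^ ℕ.pred q           ≡⟨ zeroˡ _ ⟩
    0#                          ≡⟨ sym (x+x≡0 1#) ⟩
    1# + 1#                     ∎
  ... | no  a≢x = begin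
    geometric q x a
      ≡⟨ *-cancelˡ x+a≢0 (trans (geometric-telescopes q x a) (trans (cong₂ _+_ (fermat x) (fermat a)) (sym (*-identityʳ _)))) ⟩
    1#                          ≡⟨ sym (+-identityʳ 1#) ⟩
    1# + 0#                     ∎
    where
    x+a≢0 : x + a ≢ 0#
    x+a≢0 = a≢x ∘ sym ∘ x+y≡0⇒x≡y

  geometric-poly : ∀ N x a → geometric N x a ≡ poly N (λ j → a ^ (N ℕ.∸ suc (toℕ j))) x
  geometric-poly zero    x a = refl
  geometric-poly (suc N) x a = begin
    a ^ N + x * geometric N x a                                       ≡⟨ cong (λ u → a ^ N + x * u) (geometric-poly N x a) ⟩
    a ^ N + x * poly N (λ j → a ^ (N ℕ.∸ suc (toℕ j))) x              ≡⟨ sym (poly-suc N (λ j → a ^ (suc N ℕ.∸ suc (toℕ j))) x) ⟩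
    poly (suc N) (λ j → a ^ (suc N ℕ.∸ suc (toℕ j))) x                ∎

  indicator-poly : ∀ x a → indicator x a ≡ poly q (λ j → δ 0 (toℕ j) + a ^ (q ℕ.∸ suc (toℕ j))) x
  indicator-poly x a = begin
    indicator x a                                                  ≡⟨ sym (x+[x+y]≡y 1# _) ⟩
    1# + (1# + indicator x a)                                      ≡⟨ cong₂ _+_ (sym (poly-monomial q 0 0<q x)) (sym (geometric-q x a)) ⟩
    poly q (δ 0 ∘ toℕ) x + geometric q x a                         ≡⟨ cong (poly q (δ 0 ∘ toℕ) x +_) (geometric-poly q x a) ⟩
    poly q (δ 0 ∘ toℕ) x + poly q (λ j → a ^ (q ℕ.∸ suc (toℕ j))) x
      ≡⟨ sym (poly-+ q (δ 0 ∘ toℕ) (λ j → a ^ (q ℕ.∸ suc (toℕ j))) x) ⟩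
    poly q (λ j → δ 0 (toℕ j) + a ^ (q ℕ.∸ suc (toℕ j))) x          ∎
    where
    0<q : 0 ℕ.< q
    0<q = subst (0 ℕ.<_) (sym q≡1+p) (s≤s z≤n)

  representation : ∀ G → Σ (Fin q → K) λ c → Represents c G
  representation G = c , G≡c
    where
    κ : K → Fin q → K
    κ a j = δ 0 (toℕ j) + a ^ (q ℕ.∸ suc (toℕ j))
    c : Fin q → K
    c j = ΣK (λ a → G a * κ a j)
    G≡c : Represents c G
    G≡c x = begin
      G x                                                  ≡⟨ sym (ΣK-indicator x G) ⟩
      ΣK (λ a → G a * indicator x a)                       ≡⟨ Σ-cong q (λ i → cong (G (enum i) *_) (indicator-poly x (enum i))) ⟩
      ΣK (λ a → G a * poly q (κ a) x)                      ≡⟨ Σ-cong q (λ i → Σ-*ˡ q (G (enum i)) _) ⟩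
      ΣK (λ a → Σ< q (λ j → G a * (κ a j * x ^ toℕ j)))    ≡⟨ Σ-comm q q _ ⟩
      Σ< q (λ j → ΣK (λ a → G a * (κ a j * x ^ toℕ j)))    ≡⟨ Σ-cong q (λ j → trans (Σ-cong q (λ i → sym (*-assoc _ _ _))) (sym (Σ-*ʳ q (x ^ toℕ j) _))) ⟩
      poly q c x                                           ∎

  module _ {A : K → K} (A-aff : IsAffine A) (A-bij : Bijective _≡_ _≡_ A) where

    A⁻¹ : K → K
    A⁻¹ y = proj₁ (proj₂ A-bij y)

    A∘A⁻¹ : ∀ y → A (A⁻¹ y) ≡ y
    A∘A⁻¹ y = proj₂ (proj₂ A-bij y) refl

    A⁻¹∘A : ∀ x → A⁻¹ (A x) ≡ x
    A⁻¹∘A x = proj₁ A-bij (A∘A⁻¹ (A x))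

    A⁻¹-affine : IsAffine A⁻¹
    A⁻¹-affine x y = proj₁ A-bij (begin
      A (A⁻¹ (x + y) + A⁻¹ 0#)                  ≡⟨ affine-split A-aff _ _ ⟩
      (A (A⁻¹ (x + y)) + A (A⁻¹ 0#)) + A 0#     ≡⟨ cong₂ (λ u v → (u + v) + A 0#) (A∘A⁻¹ _) (A∘A⁻¹ _) ⟩
      ((x + y) + 0#) + A 0#                     ≡⟨ cong (_+ A 0#) (+-identityʳ _) ⟩
      (x + y) + A 0#                            ≡⟨ cong₂ (λ u v → (u + v) + A 0#) (sym (A∘A⁻¹ x)) (sym (A∘A⁻¹ y)) ⟩
      (A (A⁻¹ x) + A (A⁻¹ y)) + A 0#            ≡⟨ sym (affine-split A-aff _ _) ⟩
      A (A⁻¹ x + A⁻¹ y)                         ∎)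

  Affine⇒IsAffine : ∀ {A} → Affine A → IsAffine A
  Affine⇒IsAffine {A} (c , b , A≡L+b) x y = begin
    A (x + y) + A 0#             ≡⟨ cong₂ _+_ (A≡L+b (x + y)) (A≡L+b 0#) ⟩
    (L (x + y) + b) + (L 0# + b) ≡⟨ affine-∘ (affine-+const b) (additive⇒affine L-additive) x y ⟩
    (L x + b) + (L y + b)        ≡⟨ sym (cong₂ _+_ (A≡L+b x) (A≡L+b y)) ⟩
    A x + A y                    ∎
    where
    L : K → K
    L x = Σ< (suc m) (λ j → c j * x ^ (2 ℕ.^ toℕ j))
    L-additive : ∀ x y → L (x + y) ≡ L x + L y
    L-additive x y = trans (Σ-cong (suc m) (λ j → trans (cong (c j *_) (frobenius-+ (toℕ j) x y)) (distribˡ (c j) _ _)))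
                           (Σ-+ (suc m) (λ j → c j * x ^ (2 ℕ.^ toℕ j)) (λ j → c j * y ^ (2 ℕ.^ toℕ j)))

  tr-+ : ∀ x y → tr (x + y) ≡ tr x + tr y
  tr-+ x y = trans (Σ-cong (suc m) (λ j → frobenius-+ (toℕ j) x y))
                   (Σ-+ (suc m) (λ j → x ^ (2 ℕ.^ toℕ j)) (λ j → y ^ (2 ℕ.^ toℕ j)))

  tr-*-additive : ∀ c x y → tr (c * (x + y)) ≡ tr (c * x) + tr (c * y)
  tr-*-additive c x y = trans (cong tr (distribˡ c x y)) (tr-+ (c * x) (c * y))

  deg≤-component : ∀ c {F k} → DegreeAtMost k F → DegreeAtMost k (λ x → tr (c * F x))
  deg≤-component c {k = k} = deg≤-affine∘ k (additive⇒affine (tr-*-additive c))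

  -- Components of power functions

  instance
    p-nonZero : ℕ.NonZero p
    p-nonZero = ℕ.>-nonZero 1≤p

  reduce : ℕ → ℕ
  reduce zero    = 0
  reduce (suc n) = suc (n % p)

  reduce<q : ∀ n → reduce n ℕ.< q
  reduce<q zero    = subst (0 ℕ.<_) (sym q≡1+p) (s≤s z≤n)
  reduce<q (suc n) = subst (suc (n % p) ℕ.<_) (sym q≡1+p) (s≤s (ℕDM.m%n<n n p))

  ^-reduce : ∀ x n → x ^ n ≡ x ^ reduce n
  ^-reduce x zero    = refl
  ^-reduce x (suc n) = trans (cong (λ e → x ^ suc e) (ℕDM.m≡m%n+[m/n]*n n p)) (drop-periods (n % p) (n / p))
    where
    drop-periods : ∀ s k → x ^ (suc s ℕ.+ k ℕ.* p) ≡ x ^ suc s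
    drop-periods s zero    = cong (x ^_) (ℕP.+-identityʳ (suc s))
    drop-periods s (suc k) = begin
      x ^ (suc s ℕ.+ (p ℕ.+ k ℕ.* p))  ≡⟨ cong (x ^_) (ℕ+.x∙yz≈y∙xz (suc s) p (k ℕ.* p)) ⟩
      x ^ (p ℕ.+ (suc s ℕ.+ k ℕ.* p))  ≡⟨ ^-periodic x (s≤s z≤n) ⟩
      x ^ (suc s ℕ.+ k ℕ.* p)          ≡⟨ drop-periods s k ⟩
      x ^ suc s                        ∎

  deg≤-^-2^ : ∀ {k d i} → i ℕ.< suc m → DegreeAtMost k (_^ (d ℕ.* 2 ℕ.^ i)) → DegreeAtMost k (_^ d)
  deg≤-^-2^ {k} {d} {i} i<1+m d2ⁱ≤k = deg≤-resp k root (deg≤-affine∘ k (frobenius-affine (suc m ℕ.∸ i)) d2ⁱ≤k)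
    where
    root : ∀ y → (y ^ (d ℕ.* 2 ℕ.^ i)) ^ (2 ℕ.^ (suc m ℕ.∸ i)) ≡ y ^ d
    root y = begin
      (y ^ (d ℕ.* 2 ℕ.^ i)) ^ (2 ℕ.^ (suc m ℕ.∸ i))  ≡⟨ ^-assocʳ y (d ℕ.* 2 ℕ.^ i) (2 ℕ.^ (suc m ℕ.∸ i)) ⟩
      y ^ ((d ℕ.* 2 ℕ.^ i) ℕ.* 2 ℕ.^ (suc m ℕ.∸ i))
        ≡⟨ cong (y ^_) (trans (ℕP.*-assoc d _ _) (cong (d ℕ.*_) (sym (ℕP.^-distribˡ-+-* 2 i (suc m ℕ.∸ i))))) ⟩
      y ^ (d ℕ.* 2 ℕ.^ (i ℕ.+ (suc m ℕ.∸ i)))        ≡⟨ cong (λ e → y ^ (d ℕ.* 2 ℕ.^ e)) (ℕP.m+[n∸m]≡n (ℕP.<⇒≤ i<1+m)) ⟩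
      y ^ (d ℕ.* q)                                  ≡⟨ sym (^-assocʳ y d q) ⟩
      (y ^ d) ^ q                                    ≡⟨ fermat (y ^ d) ⟩
      y ^ d                                          ∎

  poly-0 : ∀ N (c : Fin N → K) j → toℕ j ≡ 0 → poly N c 0# ≡ c j
  poly-0 N c j j≡0 = begin
    poly N c 0#           ≡⟨ Σ-single N (λ i → c i * 0# ^ toℕ i) j off ⟩
    c j * 0# ^ toℕ j      ≡⟨ cong (λ e → c j * 0# ^ e) j≡0 ⟩
    c j * 1#              ≡⟨ *-identityʳ (c j) ⟩
    c j                   ∎
    where
    off : ∀ i → i ≢ j → c i * 0# ^ toℕ i ≡ 0#
    off i i≢j = trans (cong (c i *_) (0^n≡0 (ℕP.n≢0⇒n>0 (λ i≡0 → i≢j (FinP.toℕ-injective (trans i≡0 (sym j≡0))))))) (zeroʳ (c i))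

  module _ {β : K → K} (β-additive : ∀ x y → β (x + y) ≡ β x + β y) where
    private
      cβ : Fin q → K
      cβ = proj₁ (representation β)
      β≡cβ : Represents cβ β
      β≡cβ = proj₂ (representation β)

    additive-support : ∀ j → cβ j ≢ 0# → ∃[ i ] toℕ j ≡ 2 ℕ.^ i
    additive-support j cj≢0 = w₂≡1⇒≡2^ (toℕ j) (ℕP.≤-antisym w≤1 1≤w)
      where
      w≤1 : w₂ (toℕ j) ℕ.≤ 1
      w≤1 = deg≤⇒w₂≤ β≡cβ 1 (affine⇒deg≤1 (additive⇒affine β-additive)) j cj≢0
      β0≡0 : β 0# ≡ 0#
      β0≡0 = identityʳ-unique (β 0#) (β 0#) (sym (trans (cong β (sym (+-identityʳ 0#))) (β-additive 0# 0#)))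
      1≤w : 1 ℕ.≤ w₂ (toℕ j)
      1≤w = ℕP.n≢0⇒n>0 (λ w≡0 → cj≢0 (trans (sym (poly-0 q cβ j (w₂≡0⇒≡0 (toℕ j) w≡0))) (trans (sym (β≡cβ 0#)) β0≡0)))

    module _ (d : ℕ) where
      private
        r : Fin q → ℕ
        r j = reduce (d ℕ.* toℕ j)

        monomial : ∀ j y → (y ^ d) ^ toℕ j ≡ poly q (δ (r j) ∘ toℕ) y
        monomial j y = begin
          (y ^ d) ^ toℕ j           ≡⟨ ^-assocʳ y d (toℕ j) ⟩
          y ^ (d ℕ.* toℕ j)         ≡⟨ ^-reduce y (d ℕ.* toℕ j) ⟩
          y ^ r j                   ≡⟨ sym (poly-monomial q (r j) (reduce<q (d ℕ.* toℕ j)) y) ⟩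
          poly q (δ (r j) ∘ toℕ) y  ∎

      power-coefficient : Fin q → K
      power-coefficient l = Σ< q (λ j → cβ j * δ (r j) (toℕ l))

      β∘power-representation : Represents power-coefficient (β ∘ (_^ d))
      β∘power-representation y = begin
        β (y ^ d)                                                       ≡⟨ β≡cβ (y ^ d) ⟩
        Σ< q (λ j → cβ j * (y ^ d) ^ toℕ j)                             ≡⟨ Σ-cong q (λ j → cong (cβ j *_) (monomial j y)) ⟩
        Σ< q (λ j → cβ j * poly q (δ (r j) ∘ toℕ) y)                    ≡⟨ Σ-cong q (λ j → Σ-*ˡ q (cβ j) _) ⟩
        Σ< q (λ j → Σ< q (λ l → cβ j * (δ (r j) (toℕ l) * y ^ toℕ l))) ≡⟨ Σ-comm q q _ ⟩
        Σ< q (λ l → Σ< q (λ j → cβ j * (δ (r j) (toℕ l) * y ^ toℕ l)))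
          ≡⟨ Σ-cong q (λ l → trans (Σ-cong q (λ j → sym (*-assoc _ _ _))) (sym (Σ-*ʳ q (y ^ toℕ l) _))) ⟩
        poly q power-coefficient y                                      ∎

      power-coefficient-support : ∀ l → power-coefficient l ≢ 0# → ∃[ j ] (cβ j ≢ 0# × toℕ l ≡ reduce (d ℕ.* toℕ j))
      power-coefficient-support l el≢0 =
        from-term (FinP.¬∀⟶∃¬ q (λ j → cβ j * δ (r j) (toℕ l) ≡ 0#) (λ j → cβ j * δ (r j) (toℕ l) ≟ 0#) (el≢0 ∘ Σ-zero q))
        where
        from-term : ∃[ j ] cβ j * δ (r j) (toℕ l) ≢ 0# → ∃[ j ] (cβ j ≢ 0# × toℕ l ≡ r j)
        from-term (j , term≢0) =
          j , (λ cj≡0 → term≢0 (trans (cong (_* δ (r j) (toℕ l)) cj≡0) (zeroˡ _)))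
            , δ≢0⇒≡ (λ δ≡0 → term≢0 (trans (cong (cβ j *_) δ≡0) (zeroʳ _)))

    deg≤-power-component : ∀ d k → ¬ DegreeAtMost 1 (β ∘ (_^ d)) → DegreeAtMost k (β ∘ (_^ d)) → DegreeAtMost k (_^ d)
    deg≤-power-component d k β∘P≰1 β∘P≤k =
      from-coefficient (FinP.¬∀⟶∃¬ q (λ l → power-coefficient d l ≡ 0#) (λ l → power-coefficient d l ≟ 0#) all-zero-impossible)
      where
      all-zero-impossible : ¬ (∀ l → power-coefficient d l ≡ 0#)
      all-zero-impossible e≡0 =
        β∘P≰1 (deg≤-poly q 1 (power-coefficient d) (β∘power-representation d) (λ l el≢0 → ⊥-elim (el≢0 (e≡0 l))))
      from-coefficient : ∃[ l ] power-coefficient d l ≢ 0# → DegreeAtMost k (_^ d)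
      from-coefficient (l , el≢0) = from-power-of-2 (power-coefficient-support d l el≢0)
        where
        l≤k : DegreeAtMost k (_^ toℕ l)
        l≤k = deg≤-mono (deg≤⇒w₂≤ (β∘power-representation d) k β∘P≤k l el≢0) (deg≤-monomial (toℕ l))
        from-power-of-2 : ∃[ j ] (cβ j ≢ 0# × toℕ l ≡ reduce (d ℕ.* toℕ j)) → DegreeAtMost k (_^ d)
        from-power-of-2 (j , cj≢0 , l≡rj) = from-exponent (additive-support j cj≢0)
          where
          from-exponent : ∃[ i ] toℕ j ≡ 2 ℕ.^ i → DegreeAtMost k (_^ d)
          from-exponent (i , j≡2ⁱ) = deg≤-^-2^ {k} {d} i<1+m (deg≤-resp k l≡d2ⁱ l≤k)
            where
            i<1+m : i ℕ.< suc m
            i<1+m = ℕP.≰⇒> (λ 1+m≤i → ℕP.<⇒≱ (subst (ℕ._< q) j≡2ⁱ (FinP.toℕ<n j)) (ℕP.^-monoʳ-≤ 2 1+m≤i))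
            l≡d2ⁱ : ∀ y → y ^ toℕ l ≡ y ^ (d ℕ.* 2 ℕ.^ i)
            l≡d2ⁱ y = begin
              y ^ toℕ l                       ≡⟨ cong (y ^_) l≡rj ⟩
              y ^ reduce (d ℕ.* toℕ j)        ≡⟨ sym (^-reduce y (d ℕ.* toℕ j)) ⟩
              y ^ (d ℕ.* toℕ j)               ≡⟨ cong (λ e → y ^ (d ℕ.* e)) j≡2ⁱ ⟩
              y ^ (d ℕ.* 2 ℕ.^ i)             ∎

  module EA-equivalence {F G A₁ A₂ A : K → K}
      (A₁-aff : IsAffine A₁) (A₁-bij : Bijective _≡_ _≡_ A₁)
      (A₂-aff : IsAffine A₂) (A₂-bij : Bijective _≡_ _≡_ A₂)
      (A-aff : IsAffine A) (G≡ : ∀ x → G x ≡ A₁ (F (A₂ x)) + A x) where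

    private
      B₁ B₂ : K → K
      B₁ = A⁻¹ A₁-aff A₁-bij
      B₂ = A⁻¹ A₂-aff A₂-bij
      B₁-aff : IsAffine B₁
      B₁-aff = A⁻¹-affine A₁-aff A₁-bij
      B₂-aff : IsAffine B₂
      B₂-aff = A⁻¹-affine A₂-aff A₂-bij

      F∘A₂≡ : ∀ x → F (A₂ x) ≡ B₁ (G x + A x)
      F∘A₂≡ x = trans (sym (A⁻¹∘A A₁-aff A₁-bij (F (A₂ x)))) (cong B₁ (x≡y+z⇒y≡x+z (G≡ x)))

      F≡ : ∀ y → F y ≡ B₁ (G (B₂ y) + A (B₂ y))
      F≡ y = trans (cong F (sym (A∘A⁻¹ A₂-aff A₂-bij y))) (F∘A₂≡ (B₂ y))

    deg≤-EA⁻¹ : ∀ {k} → 1 ℕ.≤ k → DegreeAtMost k G → DegreeAtMost k F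
    deg≤-EA⁻¹ {k} 1≤k G≤k = deg≤-resp k (λ y → sym (F≡′ y)) (deg≤-EA 1≤k B₁-aff B₂-aff A′≤1 G≤k)
      where
      A′ : K → K
      A′ y = B₁ (A (B₂ y)) + B₁ 0#
      A′≤1 : DegreeAtMost 1 A′
      A′≤1 = deg≤-+ 1 (affine⇒deg≤1 (affine-∘ B₁-aff (affine-∘ A-aff B₂-aff))) (deg≤-const 1 (B₁ 0#))
      F≡′ : ∀ y → F y ≡ B₁ (G (B₂ y)) + A′ y
      F≡′ y = trans (F≡ y) (trans (affine-split B₁-aff _ _) (+-assoc _ _ _))

    module _ {τ : K → K} (τ-additive : ∀ x y → τ (x + y) ≡ τ x + τ y) where

      outer : K → K
      outer u = τ (B₁ u) + τ (B₁ 0#)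

      private
        τ∘B₁-aff : IsAffine (τ ∘ B₁)
        τ∘B₁-aff = affine-∘ (additive⇒affine τ-additive) B₁-aff

        outer∘G≡ : ∀ x → outer (G x) ≡ τ (F (A₂ x)) + τ (B₁ (A x))
        outer∘G≡ x = x≡y+z⇒y≡x+z (begin
          τ (F (A₂ x))                                   ≡⟨ cong τ (F∘A₂≡ x) ⟩
          τ (B₁ (G x + A x))                             ≡⟨ affine-split τ∘B₁-aff (G x) (A x) ⟩
          (τ (B₁ (G x)) + τ (B₁ (A x))) + τ (B₁ 0#)      ≡⟨ +-xy+z≡xz+y _ _ _ ⟩
          outer (G x) + τ (B₁ (A x))                     ∎)

      outer-additive : ∀ u v → outer (u + v) ≡ outer u + outer v
      outer-additive = affine⇒shift-additive τ∘B₁-aff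

      deg≤-outer∘G : ∀ {k} → 1 ℕ.≤ k → DegreeAtMost k (τ ∘ F) → DegreeAtMost k (outer ∘ G)
      deg≤-outer∘G {k} 1≤k τ∘F≤k =
        deg≤-resp k (λ x → sym (outer∘G≡ x)) (deg≤-EA 1≤k affine-id A₂-aff (affine⇒deg≤1 (affine-∘ τ∘B₁-aff A-aff)) τ∘F≤k)

      deg≤-τ∘F : ∀ {k} → 1 ℕ.≤ k → DegreeAtMost k (outer ∘ G) → DegreeAtMost k (τ ∘ F)
      deg≤-τ∘F {k} 1≤k outer∘G≤k = deg≤-resp k τ∘F≡ (deg≤-EA 1≤k affine-id B₂-aff (affine⇒deg≤1 A′-aff) outer∘G≤k)
        where
        A′-aff : IsAffine (λ y → τ (B₁ (A (B₂ y))))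
        A′-aff = affine-∘ τ∘B₁-aff (affine-∘ A-aff B₂-aff)
        τ∘F≡ : ∀ y → outer (G (B₂ y)) + τ (B₁ (A (B₂ y))) ≡ τ (F y)
        τ∘F≡ y = trans (sym (x≡y+z⇒y≡x+z (outer∘G≡ (B₂ y)))) (cong (τ ∘ F) (A∘A⁻¹ A₂-aff A₂-bij y))

  deg≤-EA-power-component : ∀ {F d c k} → EAEquivalent F (power d) → ¬ DegreeAtMost 1 (λ x → tr (c * F x)) →
                            1 ℕ.≤ k → DegreeAtMost k (λ x → tr (c * F x)) → DegreeAtMost k F
  deg≤-EA-power-component {F} {d} {c} {k} (_ , _ , _ , (A₁-aff , A₁-bij) , (A₂-aff , A₂-bij) , A-aff , xᵈ≡) T≰1 1≤k T≤k =
    deg≤-EA⁻¹ 1≤k (deg≤-power-component (outer-additive τ-additive) d k xᵈ-component≰1 (deg≤-outer∘G τ-additive 1≤k T≤k))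
    where
    open EA-equivalence {F = F} (Affine⇒IsAffine A₁-aff) A₁-bij (Affine⇒IsAffine A₂-aff) A₂-bij (Affine⇒IsAffine A-aff) xᵈ≡
    τ-additive : ∀ x y → tr (c * (x + y)) ≡ tr (c * x) + tr (c * y)
    τ-additive = tr-*-additive c
    xᵈ-component≰1 : ¬ DegreeAtMost 1 (outer τ-additive ∘ (_^ d))
    xᵈ-component≰1 = T≰1 ∘ deg≤-τ∘F τ-additive ℕP.≤-refl

no-field-of-order-1 : ∀ {a} → ¬ GF2^ 0 a
no-field-of-order-1 𝔽 = 0≢1 (begin
  0#                                   ≡⟨ sym (Inverse.strictlyInverseˡ card 0#) ⟩
  Inverse.to card (Inverse.from card 0#) ≡⟨ cong (Inverse.to card) (Fin1-unique (Inverse.from card 0#) (Inverse.from card 1#)) ⟩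
  Inverse.to card (Inverse.from card 1#) ≡⟨ Inverse.strictlyInverseˡ card 1# ⟩
  1#                                   ∎)
  where
  open GF2^ 𝔽
  open ≡-Reasoning
  Fin1-unique : (i j : Fin 1) → i ≡ j
  Fin1-unique Fin.zero Fin.zero = refl

proposition4 : ∀ {a : Level} (m : ℕ) (𝔽 : GF2^ m a) → let open GF2^ 𝔽 in
    (F : K → K) →
    (∃[ c ] (c ≢ 0# × ∃[ dF ] ∃[ dT ] (AlgDeg F dF × AlgDeg (λ x → tr (c * F x)) dT ×
      dT ≢ 0 × dT ≢ 1 × dT ≢ dF))) →
    ∀ (d : ℕ) → ¬ EAEquivalent F (power d)
proposition4 zero    𝔽 _ _ _ _ = ⊥-elim (no-field-of-order-1 𝔽)
proposition4 (suc m) 𝔽 F (c , _ , dF , dT , F-deg , T-deg , dT≢0 , dT≢1 , dT≢dF) d F≃xᵈ =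
  dT≢dF (ℕP.≤-antisym dT≤dF dF≤dT)
  where
  open GF2^ 𝔽
  open Field 𝔽
  T≰1 : ¬ DegreeAtMost 1 (λ x → tr (c * F x))
  T≰1 T≤1 = dT≢0 (ℕP.n<1⇒n≡0 (ℕP.≤∧≢⇒< (AlgDeg-least T-deg T≤1) dT≢1))
  dT≤dF : dT ℕ.≤ dF
  dT≤dF = AlgDeg-least T-deg (deg≤-component c (AlgDeg⇒deg≤ F-deg))
  dF≤dT : dF ℕ.≤ dT
  dF≤dT = AlgDeg-least F-deg (deg≤-EA-power-component {d = d} F≃xᵈ T≰1 (ℕP.n≢0⇒n>0 dT≢0) (AlgDeg⇒deg≤ T-deg))
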